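{- Let $\Omega$ be the set of isomorphism classes of irreducible marked permutations, $\mathcal W(\Omega)$ the monoid of words over $\Omega$ under concatenation, and $\sim$ the smallest equivalence relation on $\mathcal W(\Omega)$ such that $(\xi_1,\dots,\xi_i,\xi_{i+1},\dots,\xi_k)\sim(\xi_1,\dots,\xi_{i+1},\xi_i,\dots,\xi_k)$ whenever $\{\xi_i,\xi_{i+1}\}=\{\bar1\oplus\tau_1,\tau_2\oplus\bar1\}$ for some $\oplus$-indecomposable permutations $\tau_1,\tau_2$, or $\{\xi_i,\xi_{i+1}\}=\{\bar1\ominus\pi_1,\pi_2\ominus\bar1\}$ for some $\ominus$-indecomposable permutations $\pi_1,\pi_2$. Then the star map $(\xi_1,\dots,\xi_k)\mapsto\xi_1\star\cdots\star\xi_k$ (empty word $\mapsto\bar1$) induces a monoid isomorphism from $\mathcal W(\Omega)/\sim$ to the monoid of isomorphism classes of marked permutations under the inflation product $\star$.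
   Context: A permutation on a finite set $I$ is a pair $(\le_P,\le_V)$ of total orders on $I$; isomorphism is a bijection preserving both orders, so classes of size $n$ correspond to ordinary permutations of $[n]$. For permutations (or marked permutations, see below) $\pi$ on $I$ and $\tau$ on disjoint $J$, $\pi\oplus\tau$ on $I\sqcup J$ extends both pairs of orders by $i<_P j$ and $i<_V j$ for all $i\in I,j\in J$; $\pi\ominus\tau$ instead imposes $i<_P j$ and $j<_V i$. A permutation is $\oplus$-indecomposable if it is nonempty and not of the form $\tau_1\oplus\tau_2$ with both $\tau_i$ nonempty; similarly for $\ominus$. A marked permutation on $I$ is a pair of total orders $(\le_P,\le_V)$ on $I\sqcup\{*\}$; restriction to $J\subseteq I$ restricts both orders to $J\sqcup\{*\}$; isomorphisms are bijections of $I$ which, extended by $*\mapsto*$, preserve both orders. When forming $\pi\oplus\tau$ etc. with one marked argument, the marked permutation is treated as a permutation on its set plus $*$, and the result is marked at $*$; $\bar1$ denotes the unique marked permutation on $\emptyset$. Inflation: for marked permutations $\tau^*$ on $I$ and $\pi^*$ on disjoint $J$, $\tau^*\star\pi^*$ is the marked permutation on $I\sqcup J$ obtained by replacing $*$ in $\tau^*$ by the block $J\sqcup\{*\}$ ordered as in $\pi^*$; i.e. for each of the two orders, elements of $I$ are ordered as in $\tau^*$, elements of $J\sqcup\{*\}$ as in $\pi^*$, and $x\in I$ precedes $y\in J\sqcup\{*\}$ iff $x$ precedes $*$ in $\tau^*$. This is associative with unit $\bar1$ and descends to isomorphism classes. A marked permutation $\pi^*\ne\bar1$ is irreducible if $\pi^*=\tau_1^*\star\tau_2^*$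 implies $\tau_1^*=\bar1$ or $\tau_2^*=\bar1$. -}

module Defs where

open import Data.Nat using (ℕ; zero; suc; _+_; _∸_; _<_; _<ᵇ_)
open import Data.Bool using (if_then_else_)
open import Data.List using (List; []; _∷_; _++_; map; length; upTo; foldr; [_])
open import Data.List.Relation.Binary.Permutation.Propositional using (_↭_)
open import Data.List.Relation.Unary.All using (All)
open import Data.Product using (_×_; Σ; ∃; ∃-syntax; _,_)
open import Data.Sum using (_⊎_)
open import Relation.Binary.PropositionalEquality using (_≡_)
open import Relation.Binary.Construct.Closure.Equivalence using (EqClosure)
open import Relation.Nullary using (¬_)

-- A permutation with n elements is represented (up to isomorphism) by its
-- one-line notation: a list of length n which is a rearrangement of
-- 0,1,…,n-1; the i-th entry is the ≤_V-rank of the element of ≤_P-rank i.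

Perm : Set
Perm = List ℕ

ValidPerm : Perm → Set
ValidPerm l = l ↭ upTo (length l)

-- A marked permutation on a set I with |I| = n is represented (up to
-- isomorphism) by the one-line notation 'vals' (length n+1) of the
-- underlying permutation of I ⊔ {*}, together with the ≤_P-rank 'mark' of *.
record MPerm : Set where
  constructor _at_
  field
    vals : List ℕ
    mark : ℕ
open MPerm public

ValidMPerm : MPerm → Set
ValidMPerm σ = (vals σ ↭ upTo (length (vals σ))) × (mark σ < length (vals σ))

bar1 : MPerm
bar1 = [ 0 ] at 0

_⊕ₚ_ : Perm → Perm → Perm
a ⊕ₚ b = a ++ map (length a +_) b

_⊖ₚ_ : Perm → Perm → Perm
a ⊖ₚ b = map (length b +_) a ++ b

bar1⊕_ : Perm → MPerm
bar1⊕ τ = ([ 0 ] ⊕ₚ τ) at 0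

_⊕bar1 : Perm → MPerm
τ ⊕bar1 = (τ ⊕ₚ [ 0 ]) at length τ

bar1⊖_ : Perm → MPerm
bar1⊖ π = ([ 0 ] ⊖ₚ π) at 0

_⊖bar1 : Perm → MPerm
π ⊖bar1 = (π ⊖ₚ [ 0 ]) at length π

⊕-Indecomposable : Perm → Set
⊕-Indecomposable τ = ValidPerm τ × ¬ (τ ≡ []) ×
  ¬ (Σ Perm λ τ₁ → Σ Perm λ τ₂ → ValidPerm τ₁ × ValidPerm τ₂ ×
       ¬ (τ₁ ≡ []) × ¬ (τ₂ ≡ []) × (τ₁ ⊕ₚ τ₂ ≡ τ))

⊖-Indecomposable : Perm → Set
⊖-Indecomposable τ = ValidPerm τ × ¬ (τ ≡ []) ×
  ¬ (Σ Perm λ τ₁ → Σ Perm λ τ₂ → ValidPerm τ₁ × ValidPerm τ₂ ×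
       ¬ (τ₁ ≡ []) × ¬ (τ₂ ≡ []) × (τ₁ ⊖ₚ τ₂ ≡ τ))

-- entry of a list at an index (default 0)
nth : List ℕ → ℕ → ℕ
nth []       _       = 0
nth (x ∷ xs) zero    = x
nth (x ∷ xs) (suc i) = nth xs i

-- values of I: those below b = V-rank of * stay, those above are shifted by m
shiftV : ℕ → ℕ → ℕ → ℕ
shiftV b m x = if x <ᵇ b then x else x + m

-- inflVals t a b m p: replace position a of t (whose value is b) by the
-- block p shifted by b; other values shifted by shiftV b m
inflVals : List ℕ → ℕ → ℕ → ℕ → List ℕ → List ℕ
inflVals []      _       b m p = []
inflVals (x ∷ t) zero    b m p = map (b +_) p ++ map (shiftV b m) t
inflVals (x ∷ t) (suc a) b m p = shiftV b m x ∷ inflVals t a b m p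

_⋆_ : MPerm → MPerm → MPerm
(t at a) ⋆ (p at c) =
  inflVals t a (nth t a) (length p ∸ 1) p at (a + c)

infixr 20 _⋆_

Irreducible : MPerm → Set
Irreducible ξ = ValidMPerm ξ × ¬ (ξ ≡ bar1) ×
  (∀ τ₁ τ₂ → ValidMPerm τ₁ → ValidMPerm τ₂ → τ₁ ⋆ τ₂ ≡ ξ →
     (τ₁ ≡ bar1) ⊎ (τ₂ ≡ bar1))

IsWord : List MPerm → Set
IsWord w = All Irreducible w

PairEq : MPerm → MPerm → MPerm → MPerm → Set
PairEq x y a b = (x ≡ a × y ≡ b) ⊎ (x ≡ b × y ≡ a)

Commuting : MPerm → MPerm → Set
Commuting x y =
  (Σ Perm λ τ₁ → Σ Perm λ τ₂ → ⊕-Indecomposable τ₁ × ⊕-Indecomposable τ₂ ×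
     PairEq x y (bar1⊕ τ₁) (τ₂ ⊕bar1))
  ⊎
  (Σ Perm λ π₁ → Σ Perm λ π₂ → ⊖-Indecomposable π₁ × ⊖-Indecomposable π₂ ×
     PairEq x y (bar1⊖ π₁) (π₂ ⊖bar1))

SwapStep : List MPerm → List MPerm → Set
SwapStep w w' = Σ (List MPerm) λ pre → Σ (List MPerm) λ suf →
  Σ MPerm λ x → Σ MPerm λ y → Commuting x y ×
    (w ≡ pre ++ x ∷ y ∷ suf) × (w' ≡ pre ++ y ∷ x ∷ suf)

_∼_ : List MPerm → List MPerm → Set
_∼_ = EqClosure SwapStep

star : List MPerm → MPerm
star = foldr _⋆_ bar1

-- A factorisation τ ⋆ α of a marked permutation σ is the same thing as an
-- interval of σ (a block of consecutive positions carrying consecutive values)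
-- that contains the mark: τ and α are recovered from σ and the interval. So σ
-- either has a proper such interval and splits into smaller factors, or it is
-- irreducible; by induction on size every σ is a product of irreducibles.
-- For uniqueness, let two words ξ u and η v have the same product and compare
-- the intervals of star u and star v. Equal intervals force ξ = η. Nested
-- intervals contradict the irreducibility of the outer letter. Overlapping
-- intervals have intervals as union and intersection; irreducibility makes the
-- union everything, which forces {ξ, η} = {1̄ ⊕ τ₁, τ₂ ⊕ 1̄} or
-- {1̄ ⊖ π₁, π₂ ⊖ 1̄}, and the common tail is the intersection: ξ and η commute.

module Submission where

open import Defs
open import Data.Bool using (true; false; T)
open import Data.Empty using (⊥; ⊥-elim)
open import Data.Fin using (Fin; toℕ; fromℕ<; punchOut)
import Data.Fin.Properties as FP
open import Data.List using (List; []; _∷_; _++_; map; length; upTo; [_]; applyUpTo)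
open import Data.List.Properties using (++-identityʳ; length-applyUpTo; length-++; length-map; map-upTo; upTo-∷ʳ; map-++; map-cong; map-id-local; map-∘; map-injective; ++-assoc; map-id)
open import Data.List.Membership.Propositional using (_∈_; _∉_)
open import Data.List.Membership.Propositional.Properties using (∈-upTo⁻; ∈-upTo⁺; ∈-map⁻)
open import Data.List.Membership.Propositional.Properties.WithK using (unique∧set⇒bag)
open import Data.List.Relation.Binary.BagAndSetEquality using (∼bag⇒↭)
open import Data.List.Relation.Unary.Any using (here; there)
open import Data.List.Relation.Unary.All as All using (All; []; _∷_)
import Data.List.Relation.Unary.All.Properties as AllP
open import Data.List.Relation.Unary.All.Properties using (All¬⇒¬Any; ¬Any⇒All¬)
open import Data.List.Relation.Unary.Unique.Propositional using (Unique; []; _∷_)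
open import Data.List.Relation.Unary.Unique.Propositional.Properties using (upTo⁺)
open import Data.List.Relation.Binary.Permutation.Propositional using (_↭_; ↭-sym; ↭-trans; ↭-prep; ↭⇒↭ₛ)
open import Data.List.Relation.Binary.Permutation.Propositional.Properties using (∈-resp-↭; ++-comm; ++⁺ʳ; map⁺; drop-mid)
import Data.List.Relation.Binary.Permutation.Setoid.Properties as PSP
open import Data.Nat
open import Data.Nat.Properties
open import Data.Nat.Tactic.RingSolver using (solve-∀)
open import Data.Product using (_×_; Σ; _,_; proj₁; proj₂)
open import Data.Sum using (_⊎_; inj₁; inj₂; [_,_]′)
import Data.Sum as Sum
open import Function using (_∘_)
open import Function.Bundles using (mk⇔)
open import Relation.Binary.Construct.Closure.ReflexiveTransitive using (ε; _◅_; _◅◅_)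
open import Relation.Binary.Construct.Closure.Symmetric using (fwd; bwd)
import Relation.Binary.Construct.Closure.Equivalence as EC
open import Relation.Binary.Definitions using (Tri; tri<; tri≈; tri>)
open import Relation.Binary.PropositionalEquality hiding ([_])
open import Relation.Nullary using (¬_; Dec; yes; no; contradiction)
open import Relation.Nullary.Decidable using (_×-dec_; _→-dec_; map′)

nth-++ˡ : ∀ (l r : List ℕ) {i} → i < length l → nth (l ++ r) i ≡ nth l i
nth-++ˡ (x ∷ l) r {zero} _ = refl
nth-++ˡ (x ∷ l) r {suc i} (s≤s p) = nth-++ˡ l r p

nth-++ʳ : ∀ (l r : List ℕ) i → nth (l ++ r) (length l + i) ≡ nth r i
nth-++ʳ [] r i = refl
nth-++ʳ (x ∷ l) r i = nth-++ʳ l r i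

nth-map : ∀ f (l : List ℕ) {i} → i < length l → nth (map f l) i ≡ f (nth l i)
nth-map f (x ∷ l) {zero} _ = refl
nth-map f (x ∷ l) {suc i} (s≤s p) = nth-map f l p

nth-ext : ∀ (l l′ : List ℕ) → length l ≡ length l′ → (∀ i → i < length l → nth l i ≡ nth l′ i) → l ≡ l′
nth-ext [] [] _ _ = refl
nth-ext (x ∷ l) (y ∷ l′) e h = cong₂ _∷_ (h 0 (s≤s z≤n)) (nth-ext l l′ (suc-injective e) (λ i p → h (suc i) (s≤s p)))

nth-∈ : ∀ (l : List ℕ) {i} → i < length l → nth l i ∈ l
nth-∈ (x ∷ l) {zero} _ = here refl
nth-∈ (x ∷ l) {suc i} (s≤s p) = there (nth-∈ l p)

∈-nth : ∀ {x} (l : List ℕ) → x ∈ l → Σ ℕ λ i → i < length l × nth l i ≡ x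
∈-nth (y ∷ l) (here refl) = 0 , s≤s z≤n , refl
∈-nth (y ∷ l) (there p) with ∈-nth l p
... | i , q , e = suc i , s≤s q , e

nth-applyUpTo : ∀ (f : ℕ → ℕ) n i → i < n → nth (applyUpTo f n) i ≡ f i
nth-applyUpTo f (suc n) zero _ = refl
nth-applyUpTo f (suc n) (suc i) (s≤s q) = nth-applyUpTo (f ∘ suc) n i q

-- ValidPerm in a form that can be checked entry by entry.
record IsPermutation (l : List ℕ) : Set where
  constructor isPermutation
  field
    nth-< : ∀ {i} → i < length l → nth l i < length l
    nth-injective : ∀ {i j} → i < length l → j < length l → nth l i ≡ nth l j → i ≡ j
open IsPermutation public

Unique⇒nth-injective : ∀ (l : List ℕ) → Unique l → ∀ {i j} → i < length l → j < length l → nth l i ≡ nth l j → i ≡ j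
Unique⇒nth-injective (x ∷ l) (x∉l ∷ u) {zero} {zero} _ _ _ = refl
Unique⇒nth-injective (x ∷ l) (x∉l ∷ u) {zero} {suc j} _ (s≤s q) e = ⊥-elim (All¬⇒¬Any x∉l (subst (_∈ l) (sym e) (nth-∈ l q)))
Unique⇒nth-injective (x ∷ l) (x∉l ∷ u) {suc i} {zero} (s≤s p) _ e = ⊥-elim (All¬⇒¬Any x∉l (subst (_∈ l) e (nth-∈ l p)))
Unique⇒nth-injective (x ∷ l) (x∉l ∷ u) {suc i} {suc j} (s≤s p) (s≤s q) e = cong suc (Unique⇒nth-injective l u p q e)

nth-injective⇒Unique : ∀ (l : List ℕ) → (∀ {i j} → i < length l → j < length l → nth l i ≡ nth l j → i ≡ j) → Unique l
nth-injective⇒Unique [] _ = []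
nth-injective⇒Unique (x ∷ l) h = ¬Any⇒All¬ l x∉l ∷ nth-injective⇒Unique l (λ p q e → suc-injective (h (s≤s p) (s≤s q) e))
  where
  x∉l : x ∉ l
  x∉l x∈l = let (i , q , e) = ∈-nth l x∈l in 0≢1+n (h (s≤s z≤n) (s≤s q) (sym e))

injective⇒surjective : ∀ n (g : ℕ → ℕ) → (∀ {i} → i < n → g i < n) → (∀ {i j} → i < n → j < n → g i ≡ g j → i ≡ j)
  → ∀ {y} → y < n → Σ ℕ λ i → i < n × g i ≡ y
injective⇒surjective zero g g-< g-inj ()
injective⇒surjective (suc n) g g-< g-inj {y} y<n with FP.any? {suc n} (λ i → g (toℕ i) ≟ y)
... | yes (i , e) = toℕ i , FP.toℕ<n i , e
... | no y∉img = contradiction (FP.pigeonhole (n<1+n n) (λ i → punchOut (y≢g′ i)))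
  (λ (i , j , i<j , e) → <-irrefl (g′-injective (FP.punchOut-injective (y≢g′ i) (y≢g′ j) e)) i<j)
  where
  g′ : Fin (suc n) → Fin (suc n)
  g′ i = fromℕ< (g-< (FP.toℕ<n i))
  toℕ-g′ : ∀ i → toℕ (g′ i) ≡ g (toℕ i)
  toℕ-g′ i = FP.toℕ-fromℕ< _
  y≢g′ : ∀ i → fromℕ< y<n ≢ g′ i
  y≢g′ i e = y∉img (i , trans (sym (toℕ-g′ i)) (trans (sym (cong toℕ e)) (FP.toℕ-fromℕ< y<n)))
  g′-injective : ∀ {i j} → g′ i ≡ g′ j → toℕ i ≡ toℕ j
  g′-injective {i} {j} e = g-inj (FP.toℕ<n i) (FP.toℕ<n j) (trans (sym (toℕ-g′ i)) (trans (cong toℕ e) (toℕ-g′ j)))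

nth-surjective : ∀ {l} → IsPermutation l → ∀ {y} → y < length l → Σ ℕ λ i → i < length l × nth l i ≡ y
nth-surjective {l} v = injective⇒surjective (length l) (nth l) (nth-< v) (nth-injective v)

↭upTo⇒IsPermutation : ∀ (l : List ℕ) → l ↭ upTo (length l) → IsPermutation l
↭upTo⇒IsPermutation l p = isPermutation (λ q → ∈-upTo⁻ (∈-resp-↭ p (nth-∈ l q)))
  (Unique⇒nth-injective l (PSP.Unique-resp-↭ (setoid ℕ) (↭⇒↭ₛ (↭-sym p)) (upTo⁺ (length l))))

IsPermutation⇒↭upTo : ∀ (l : List ℕ) → IsPermutation l → l ↭ upTo (length l)
IsPermutation⇒↭upTo l v = ∼bag⇒↭ (unique∧set⇒bag (nth-injective⇒Unique l (nth-injective v)) (upTo⁺ (length l)) (mk⇔ ⊆ ⊇))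
  where
  ⊆ : ∀ {x} → x ∈ l → x ∈ upTo (length l)
  ⊆ x∈l = let (i , p , e) = ∈-nth l x∈l in ∈-upTo⁺ (subst (_< length l) e (nth-< v p))
  ⊇ : ∀ {x} → x ∈ upTo (length l) → x ∈ l
  ⊇ x∈upTo = let (i , p , e) = nth-surjective v (∈-upTo⁻ x∈upTo) in subst (_∈ l) e (nth-∈ l p)

split≤ : ∀ {a i} → a ≤ i → Σ ℕ λ j → i ≡ a + j
split≤ {zero} {i} _ = i , refl
split≤ {suc a} {suc i} (s≤s p) with split≤ p
... | j , e = j , cong suc e

shiftV-lt : ∀ {b m x} → x < b → shiftV b m x ≡ x
shiftV-lt {b} {m} {x} p with x <ᵇ b in eq
... | true = refl
... | false = ⊥-elim (subst T eq (<⇒<ᵇ p))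

shiftV-ge : ∀ {b m x} → b ≤ x → shiftV b m x ≡ x + m
shiftV-ge {b} {m} {x} p with x <ᵇ b in eq
... | true = ⊥-elim (<⇒≱ (<ᵇ⇒< x b (subst T (sym eq) _)) p)
... | false = refl

shiftV-injective : ∀ {b m x y} → shiftV b m x ≡ shiftV b m y → x ≡ y
shiftV-injective {b} {m} {x} {y} e with x <? b | y <? b
... | yes p | yes q = trans (sym (shiftV-lt p)) (trans e (shiftV-lt q))
... | no p | no q = +-cancelʳ-≡ m x y (trans (sym (shiftV-ge (≮⇒≥ p))) (trans e (shiftV-ge (≮⇒≥ q))))
... | yes p | no q = ⊥-elim (<⇒≱ (<-≤-trans p (≤-trans (≮⇒≥ q) (m≤m+n y m))) (≤-reflexive (sym (trans (sym (shiftV-lt p)) (trans e (shiftV-ge (≮⇒≥ q)))))))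
... | no p | yes q = ⊥-elim (<⇒≱ (<-≤-trans q (≤-trans (≮⇒≥ p) (m≤m+n x m))) (≤-reflexive (sym (trans (sym (shiftV-lt q)) (trans (sym e) (shiftV-ge (≮⇒≥ p)))))))

shiftV≤+ : ∀ b m x → shiftV b m x ≤ x + m
shiftV≤+ b m x with x <? b
... | yes p = ≤-trans (≤-reflexive (shiftV-lt p)) (m≤m+n x m)
... | no p = ≤-reflexive (shiftV-ge (≮⇒≥ p))

shiftV-avoids-block : ∀ {b m x} → x ≢ b → b ≤ shiftV b m x → shiftV b m x < b + suc m → ⊥
shiftV-avoids-block {b} {m} {x} ne p q with x <? b
... | yes lt = <⇒≱ lt (subst (b ≤_) (shiftV-lt lt) p)
... | no nlt = <⇒≱ (subst (_< b + suc m) (shiftV-ge (≮⇒≥ nlt)) q)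
     (subst (_≤ x + m) (sym (+-suc b m)) (+-monoˡ-≤ m (≤∧≢⇒< (≮⇒≥ nlt) (λ e → ne (sym e)))))

shiftV-identity : ∀ b y → shiftV b 0 y ≡ y
shiftV-identity b y with y <? b
... | yes lt = shiftV-lt lt
... | no nlt = trans (shiftV-ge (≮⇒≥ nlt)) (+-identityʳ y)

module _ {b m : ℕ} {p : List ℕ} where

  inflVals-length : ∀ t a → a < length t → suc (length (inflVals t a b m p)) ≡ length t + length p
  inflVals-length (x ∷ t) zero _ = begin
    suc (length (map (b +_) p ++ map (shiftV b m) t)) ≡⟨ cong suc (length-++ (map (b +_) p)) ⟩
    suc (length (map (b +_) p) + length (map (shiftV b m) t)) ≡⟨ cong suc (cong₂ _+_ (length-map (b +_) p) (length-map (shiftV b m) t)) ⟩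
    suc (length p + length t) ≡⟨ cong suc (+-comm (length p) (length t)) ⟩
    suc (length t + length p) ∎
    where open ≡-Reasoning
  inflVals-length (x ∷ t) (suc a) (s≤s q) = cong suc (inflVals-length t a q)
  inflVals-before : ∀ t a i → i < a → a < length t → nth (inflVals t a b m p) i ≡ shiftV b m (nth t i)
  inflVals-before (x ∷ t) (suc a) zero _ _ = refl
  inflVals-before (x ∷ t) (suc a) (suc i) (s≤s q) (s≤s r) = inflVals-before t a i q r

  inflVals-block : ∀ t a j → a < length t → j < length p → nth (inflVals t a b m p) (a + j) ≡ b + nth p j
  inflVals-block (x ∷ t) zero j _ q = trans (nth-++ˡ (map (b +_) p) (map (shiftV b m) t) (subst (j <_) (sym (length-map (b +_) p)) q)) (nth-map (b +_) p q)
  inflVals-block (x ∷ t) (suc a) j (s≤s r) q = inflVals-block t a j r q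

  inflVals-after : ∀ t a i → a < i → i < length t → length p ≡ suc m → nth (inflVals t a b m p) (i + m) ≡ shiftV b m (nth t i)
  inflVals-after (x ∷ t) zero (suc i) _ (s≤s r) e =
    trans (cong (nth (map (b +_) p ++ map (shiftV b m) t)) idx)
      (trans (nth-++ʳ (map (b +_) p) (map (shiftV b m) t) i) (nth-map (shiftV b m) t r))
    where
    idx : suc i + m ≡ length (map (b +_) p) + i
    idx = trans (cong suc (+-comm i m)) (cong (_+ i) (sym (trans (length-map (b +_) p) e)))
  inflVals-after (x ∷ t) (suc a) (suc i) (s≤s q) (s≤s r) e = inflVals-after t a i q r e

  inflVals-view : ∀ t a i → a < length t → length p ≡ suc m → i < length (inflVals t a b m p) →
    (i < a) ⊎ (Σ ℕ λ j → j < length p × i ≡ a + j) ⊎ (Σ ℕ λ i′ → a < i′ × i′ < length t × i ≡ i′ + m)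
  inflVals-view t a i q e r with i <? a
  ... | yes lt = inj₁ lt
  ... | no nlt with split≤ (≮⇒≥ nlt)
  ... | j , refl with j <? length p
  ... | yes jl = inj₂ (inj₁ (j , jl , refl))
  ... | no njl with split≤ (≮⇒≥ njl)
  ... | k , refl = inj₂ (inj₂ (suc (a + k) , s≤s (m≤m+n a k) , bound , index))
    where
    index : a + (length p + k) ≡ suc (a + k) + m
    index rewrite e = shuffle a m k
      where
      shuffle : ∀ a m k → a + (suc m + k) ≡ suc (a + k) + m
      shuffle = solve-∀
    bound : suc (a + k) < length t
    bound = +-cancelʳ-≤ (length p) (suc (suc (a + k))) (length t) (begin
      suc (suc (a + k)) + length p       ≡⟨ shuffle a k (length p) ⟩
      suc (suc (a + (length p + k)))     ≤⟨ s≤s r ⟩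
      suc (length (inflVals t a b m p))  ≡⟨ inflVals-length t a q ⟩
      length t + length p                ∎)
      where
      open ≤-Reasoning
      shuffle : ∀ a k l → suc (suc (a + k)) + l ≡ suc (suc (a + (l + k)))
      shuffle = solve-∀

-- Inflation

IsMPerm : MPerm → Set
IsMPerm σ = IsPermutation (vals σ) × mark σ < length (vals σ)

≡suc-pred : ∀ {k} → 0 < k → k ≡ suc (k ∸ 1)
≡suc-pred {suc k} _ = refl

module Inflation (τ α : MPerm) (vτ : IsMPerm τ) (vα : IsMPerm α) where
  t = vals τ
  a = mark τ
  p = vals α
  c = mark α
  k = length p
  m = k ∸ 1
  b = nth t a
  s = vals (τ ⋆ α)
  ek : k ≡ suc m
  ek = ≡suc-pred (≤-<-trans z≤n (proj₂ vα))
  a<t : a < length t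
  a<t = proj₂ vτ
  b<t : b < length t
  b<t = nth-< (proj₁ vτ) a<t
  suc-length : suc (length s) ≡ length t + k
  suc-length = inflVals-length {b} {m} {p} t a a<t
  length≡ : length s ≡ length t + m
  length≡ = suc-injective (trans suc-length (trans (cong (length t +_) ek) (+-suc (length t) m)))

  position-view : ∀ i → i < length s → (i < a) ⊎ (Σ ℕ λ j → j < k × i ≡ a + j) ⊎ (Σ ℕ λ i' → a < i' × i' < length t × i ≡ i' + m)
  position-view i q = inflVals-view {b} {m} {p} t a i a<t ek q

  before : ∀ i → i < a → nth s i ≡ shiftV b m (nth t i)
  before i q = inflVals-before {b} {m} {p} t a i q a<t
  inside : ∀ j → j < k → nth s (a + j) ≡ b + nth p j
  inside j q = inflVals-block {b} {m} {p} t a j a<t q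
  after : ∀ i → a < i → i < length t → nth s (i + m) ≡ shiftV b m (nth t i)
  after i q r = inflVals-after {b} {m} {p} t a i q r ek

  nth≢b : ∀ i → i < length t → ¬ i ≡ a → ¬ nth t i ≡ b
  nth≢b i q ne e = ne (nth-injective (proj₁ vτ) q a<t e)

  outside-avoids-block : ∀ i → i < length t → ¬ i ≡ a → b ≤ shiftV b m (nth t i) → shiftV b m (nth t i) < b + k → ⊥
  outside-avoids-block i q ne x y = shiftV-avoids-block (nth≢b i q ne) x (subst (λ z → shiftV b m (nth t i) < b + z) ek y)

  block-image : ∀ j → j < k → b ≤ nth s (a + j) × nth s (a + j) < b + k
  block-image j q = subst (b ≤_) (sym (inside j q)) (m≤m+n b _) , subst (_< b + k) (sym (inside j q)) (+-monoʳ-< b (nth-< (proj₁ vα) q))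

  block-preimage : ∀ i → i < length s → b ≤ nth s i → nth s i < b + k → Σ ℕ λ j → j < k × i ≡ a + j
  block-preimage i q x y with position-view i q
  ... | inj₁ lt = ⊥-elim (outside-avoids-block i (<-trans lt a<t) (<⇒≢ lt) (subst (b ≤_) (before i lt) x) (subst (_< b + k) (before i lt) y))
  ... | inj₂ (inj₁ r) = r
  ... | inj₂ (inj₂ (i' , u , v , refl)) = ⊥-elim (outside-avoids-block i' v (>⇒≢ u) (subst (b ≤_) (after i' u v) x) (subst (_< b + k) (after i' u v) y))

  OutsideBlock : ℕ → Set
  OutsideBlock i = Σ ℕ λ i' → i' < length t × ¬ i' ≡ a × nth s i ≡ shiftV b m (nth t i') × ((i < a × i ≡ i') ⊎ (a < i' × i ≡ i' + m))

  block-view : ∀ i → i < length s → (Σ ℕ λ j → j < k × i ≡ a + j) ⊎ OutsideBlock i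
  block-view i q with position-view i q
  ... | inj₁ lt = inj₂ (i , <-trans lt a<t , <⇒≢ lt , before i lt , inj₁ (lt , refl))
  ... | inj₂ (inj₁ r) = inj₁ r
  ... | inj₂ (inj₂ (i' , u , v , refl)) = inj₂ (i' , v , >⇒≢ u , after i' u v , inj₂ (u , refl))

  abstract
    isMPerm : IsMPerm (τ ⋆ α)
    isMPerm = isPermutation bd ij , mk
      where
      ltR : ∀ x → x < length t → x + m < length s
      ltR x q = subst (x + m <_) (sym length≡) (+-monoˡ-< m q)
      bd : ∀ {i} → i < length s → nth s i < length s
      bd {i} q with position-view i q
      ... | inj₁ lt rewrite before i lt = ≤-<-trans (shiftV≤+ b m _) (ltR _ (nth-< (proj₁ vτ) (<-trans lt a<t)))
      ... | inj₂ (inj₁ (j , jk , refl)) rewrite inside j jk = <-≤-trans (+-monoʳ-< b (nth-< (proj₁ vα) jk))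
            (subst (b + k ≤_) (sym length≡) (subst (λ z → b + z ≤ length t + m) (sym ek) (subst (_≤ length t + m) (sym (+-suc b m)) (+-monoˡ-≤ m b<t))))
      ... | inj₂ (inj₂ (i' , u , v , refl)) rewrite after i' u v = ≤-<-trans (shiftV≤+ b m _) (ltR _ (nth-< (proj₁ vτ) v))
      mixed : ∀ x j → x < k → nth s (a + x) ≡ nth s j → OutsideBlock j → ⊥
      mixed x j xk e (j' , r , ne , e' , _) =
        outside-avoids-block j' r ne (subst (b ≤_) (trans e e') (proj₁ (block-image x xk))) (subst (_< b + k) (trans e e') (proj₂ (block-image x xk)))
      ij : ∀ {i j} → i < length s → j < length s → nth s i ≡ nth s j → i ≡ j
      ij {i} {j} qi qj e with block-view i qi | block-view j qj
      ... | inj₁ (x , xk , refl) | inj₁ (y , yk , refl) =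
            cong (a +_) (nth-injective (proj₁ vα) xk yk (+-cancelˡ-≡ b _ _ (trans (sym (inside x xk)) (trans e (inside y yk)))))
      ... | inj₁ (x , xk , refl) | inj₂ nb = ⊥-elim (mixed x j xk e nb)
      ... | inj₂ nb | inj₁ (y , yk , refl) = ⊥-elim (mixed y i yk (sym e) nb)
      ... | inj₂ (i' , r , ne , e1 , c1) | inj₂ (j' , r' , ne' , e2 , c2) with nth-injective (proj₁ vτ) r r' (shiftV-injective {b} {m} (trans (sym e1) (trans e e2)))
      ... | refl with c1 | c2
      ... | inj₁ (_ , refl) | inj₁ (_ , refl) = refl
      ... | inj₂ (_ , refl) | inj₂ (_ , refl) = refl
      ... | inj₁ (lt , refl) | inj₂ (gt , _) = ⊥-elim (<-asym lt gt)
      ... | inj₂ (gt , _) | inj₁ (lt , refl) = ⊥-elim (<-asym lt gt)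
      mk : a + c < length s
      mk = subst (a + c <_) (sym length≡) (<-≤-trans (+-monoʳ-< a (subst (c <_) ek (proj₂ vα))) (subst (_≤ length t + m) (sym (+-suc a m)) (+-monoˡ-≤ m a<t)))

shiftV-shiftV : ∀ {b m1 m2 y0 x} → ¬ x ≡ b → y0 ≤ m1 → shiftV (b + y0) m2 (shiftV b m1 x) ≡ shiftV b (m1 + m2) x
shiftV-shiftV {b} {m1} {m2} {y0} {x} ne le with x <? b
... | yes lt = trans (cong (shiftV (b + y0) m2) (shiftV-lt lt)) (trans (shiftV-lt (<-≤-trans lt (m≤m+n b y0))) (sym (shiftV-lt lt)))
... | no nlt = trans (cong (shiftV (b + y0) m2) (shiftV-ge {b} {m1} (≮⇒≥ nlt)))
    (trans (shiftV-ge {b + y0} {m2} (≤-trans (+-monoʳ-≤ b le) (≤-trans (m≤n+m (b + m1) 1) (+-monoˡ-≤ m1 (≤∧≢⇒< (≮⇒≥ nlt) (λ e → ne (sym e)))))))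
      (trans (+-assoc x m1 m2) (sym (shiftV-ge {b} {m1 + m2} (≮⇒≥ nlt)))))

shiftV-+ : ∀ b y0 m y → shiftV (b + y0) m (b + y) ≡ b + shiftV y0 m y
shiftV-+ b y0 m y with y <? y0
... | yes lt = trans (shiftV-lt (+-monoʳ-< b lt)) (cong (b +_) (sym (shiftV-lt lt)))
... | no nlt = trans (shiftV-ge (+-monoʳ-≤ b (≮⇒≥ nlt))) (trans (+-assoc b y m) (cong (b +_) (sym (shiftV-ge (≮⇒≥ nlt)))))

module Cancellation (t : List ℕ) (a : ℕ) (p : List ℕ) (c : ℕ) (t' p' : List ℕ) (c' : ℕ)
  (vτ : IsMPerm (t at a)) (vα : IsMPerm (p at c)) (vτ' : IsMPerm (t' at a)) (vα' : IsMPerm (p' at c'))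
  (eq : (t at a) ⋆ (p at c) ≡ (t' at a) ⋆ (p' at c')) (ek : length p ≡ length p') where
  module I = Inflation (t at a) (p at c) vτ vα
  module I' = Inflation (t' at a) (p' at c') vτ' vα'
  es : I.s ≡ I'.s
  es = cong vals eq

  block-base-≤ : ∀ {p p' b b'} → length p ≡ length p' → IsPermutation p' → 0 < length p' →
    (∀ j → j < length p → nth I.s (a + j) ≡ b + nth p j) → (∀ j → j < length p' → nth I.s (a + j) ≡ b' + nth p' j) → b ≤ b'
  block-base-≤ {p} {p'} {b} {b'} e v 0<length f g with nth-surjective v 0<length
  ... | j , jl , z = subst (b ≤_) (trans (g j jl) (trans (cong (b' +_) z) (+-identityʳ b'))) (subst (b ≤_) (sym (f j (subst (j <_) (sym e) jl))) (m≤m+n b _))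

  0<length : ∀ {q c} → IsMPerm (q at c) → 0 < length q
  0<length (_ , x) = <-≤-trans (s≤s z≤n) x

  eb : I.b ≡ I'.b
  eb = ≤-antisym (block-base-≤ {p} {p'} ek (proj₁ vα') (0<length vα') I.inside (λ j q → trans (cong (λ z → nth z (a + j)) es) (I'.inside j q)))
                 (block-base-≤ {p'} {p} (sym ek) (proj₁ vα) (0<length vα) (λ j q → trans (cong (λ z → nth z (a + j)) es) (I'.inside j q)) I.inside)

  ep : p ≡ p'
  ep = nth-ext p p' ek (λ j q → +-cancelˡ-≡ I.b _ _ (trans (sym (I.inside j q)) (trans (cong (λ z → nth z (a + j)) es) (trans (I'.inside j (subst (j <_) ek q)) (cong (_+ nth p' j) (sym eb))))))

  ec : c ≡ c'
  ec = +-cancelˡ-≡ a c c' (cong mark eq)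

  em : I.m ≡ I'.m
  em = cong (_∸ 1) ek

  et : t ≡ t'
  et = nth-ext t t' elen pt
    where
    elen : length t ≡ length t'
    elen = +-cancelʳ-≡ (length p) _ _ (trans (sym I.suc-length) (trans (cong (λ z → suc (length z)) es) (trans I'.suc-length (cong (length t' +_) (sym ek)))))
    pt : ∀ i → i < length t → nth t i ≡ nth t' i
    pt i q with <-cmp i a
    ... | tri< lt _ _ = shiftV-injective {I.b} {I.m} (trans (sym (I.before i lt)) (trans (cong (λ z → nth z i) es) (trans (I'.before i lt) (cong₂ (λ u v → shiftV u v (nth t' i)) (sym eb) (sym em)))))
    ... | tri≈ _ refl _ = eb
    ... | tri> _ _ gt = shiftV-injective {I.b} {I.m} (trans (sym (I.after i gt q)) (trans (cong (λ z → nth z (i + I.m)) es) 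
        (trans (cong (λ v → nth I'.s (i + v)) em) (trans (I'.after i gt (subst (i <_) elen q)) (cong₂ (λ u v → shiftV u v (nth t' i)) (sym eb) (sym em))))))

abstract
  ⋆-cancel : ∀ τ α τ' α' → IsMPerm τ → IsMPerm α → IsMPerm τ' → IsMPerm α' → τ ⋆ α ≡ τ' ⋆ α' → mark τ ≡ mark τ' →
    length (vals α) ≡ length (vals α') → τ ≡ τ' × α ≡ α'
  ⋆-cancel (t at a) (p at c) (t' at a') (p' at c') vτ vα vτ' vα' eq refl ek =
    cong₂ _at_ C.et refl , cong₂ _at_ C.ep C.ec
    where
    module C = Cancellation t a p c t' p' c' vτ vα vτ' vα' eq ek

module Associativity (τ α β : MPerm) (vτ : IsMPerm τ) (vα : IsMPerm α) (vβ : IsMPerm β) where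
  module I1 = Inflation τ α vτ vα
  vA = I1.isMPerm
  module I2 = Inflation (τ ⋆ α) β vA vβ
  module J1 = Inflation α β vα vβ
  vB = J1.isMPerm
  module J2 = Inflation τ (α ⋆ β) vτ vB

  eJm : J2.m ≡ I1.m + J1.m
  eJm = suc-injective (trans (sym J2.ek) (trans J1.length≡ (cong (_+ J1.m) I1.ek)))
  ebA : I2.b ≡ I1.b + nth I1.p I1.c
  ebA = I1.inside I1.c (proj₂ vα)
  pc≤ : nth I1.p I1.c ≤ I1.m
  pc≤ = s≤s⁻¹ (subst (nth I1.p I1.c <_) I1.ek (nth-< (proj₁ vα) (proj₂ vα)))
  c≤m : I1.c ≤ I1.m
  c≤m = s≤s⁻¹ (subst (I1.c <_) I1.ek (proj₂ vα))

  lenEq : length I2.s ≡ length J2.s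
  lenEq = trans I2.length≡ (trans (cong (_+ J1.m) I1.length≡) (trans (+-assoc (length I1.t) I1.m J1.m) (trans (cong (length I1.t +_) (sym eJm)) (sym J2.length≡))))

  pw : ∀ i → i < length J2.s → nth I2.s i ≡ nth J2.s i
  pw i q with J2.position-view i q
  ... | inj₁ lt = trans (I2.before i (<-≤-trans lt (m≤m+n I1.a I1.c)))
                  (trans (cong (shiftV I2.b J1.m) (I1.before i lt))
                  (trans (cong (λ z → shiftV z J1.m (shiftV I1.b I1.m (nth I1.t i))) ebA)
                  (trans (shiftV-shiftV (I1.nth≢b i (<-trans lt I1.a<t) (<⇒≢ lt)) pc≤)
                  (trans (cong (λ z → shiftV I1.b z (nth I1.t i)) (sym eJm)) (sym (J2.before i lt))))))
  ... | inj₂ (inj₂ (i' , u , v , refl)) = trans (cong (nth I2.s) idx)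
                  (trans (I2.after (i' + I1.m) gt lt2)
                  (trans (cong (shiftV I2.b J1.m) (I1.after i' u v))
                  (trans (cong (λ z → shiftV z J1.m (shiftV I1.b I1.m (nth I1.t i'))) ebA)
                  (trans (shiftV-shiftV (I1.nth≢b i' v (>⇒≢ u)) pc≤)
                  (trans (cong (λ z → shiftV I1.b z (nth I1.t i')) (sym eJm)) (sym (J2.after i' u v)))))))
    where
    idx : i' + J2.m ≡ i' + I1.m + J1.m
    idx = trans (cong (i' +_) eJm) (sym (+-assoc i' I1.m J1.m))
    gt : I1.a + I1.c < i' + I1.m
    gt = +-mono-<-≤ u c≤m
    lt2 : i' + I1.m < length I1.s
    lt2 = subst (i' + I1.m <_) (sym I1.length≡) (+-monoˡ-< I1.m v)
  ... | inj₂ (inj₁ (j , jl , refl)) with J1.position-view j jl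
  ... | inj₁ lt = trans (I2.before (I1.a + j) (+-monoʳ-< I1.a lt))
                  (trans (cong (shiftV I2.b J1.m) (I1.inside j (<-trans lt (<-≤-trans (proj₂ vα) ≤-refl))))
                  (trans (cong (λ z → shiftV z J1.m (I1.b + nth I1.p j)) ebA)
                  (trans (shiftV-+ I1.b (nth I1.p I1.c) J1.m (nth I1.p j))
                  (trans (cong (I1.b +_) (sym (J1.before j lt))) (sym (J2.inside j jl))))))
  ... | inj₂ (inj₁ (l , ll , refl)) = trans (cong (nth I2.s) (sym (+-assoc I1.a I1.c l)))
                  (trans (I2.inside l ll)
                  (trans (cong (_+ nth J1.p l) ebA)
                  (trans (+-assoc I1.b _ _)
                  (trans (cong (I1.b +_) (sym (J1.inside l ll))) (sym (J2.inside (I1.c + l) jl))))))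
  ... | inj₂ (inj₂ (j' , u , v , refl)) = trans (cong (nth I2.s) (sym (+-assoc I1.a j' J1.m)))
                  (trans (I2.after (I1.a + j') (+-monoʳ-< I1.a u) lt2)
                  (trans (cong (shiftV I2.b J1.m) (I1.inside j' v))
                  (trans (cong (λ z → shiftV z J1.m (I1.b + nth I1.p j')) ebA)
                  (trans (shiftV-+ I1.b (nth I1.p I1.c) J1.m (nth I1.p j'))
                  (trans (cong (I1.b +_) (sym (J1.after j' u v))) (sym (J2.inside (j' + J1.m) jl)))))))
    where
    lt2 : I1.a + j' < length I1.s
    lt2 = subst (I1.a + j' <_) (sym I1.length≡) (<-≤-trans (+-monoʳ-< I1.a (subst (j' <_) I1.ek v)) (≤-trans (≤-reflexive (+-suc I1.a I1.m)) (+-monoˡ-≤ I1.m I1.a<t)))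

  abstract
    ⋆-assoc : (τ ⋆ α) ⋆ β ≡ τ ⋆ (α ⋆ β)
    ⋆-assoc = cong₂ _at_ (nth-ext I2.s J2.s lenEq (λ i q → pw i (subst (i <_) lenEq q))) (+-assoc I1.a I1.c J1.c)

-- Intervals and factorisations

record Block (s : List ℕ) (a k b : ℕ) : Set where
  constructor mkBlock
  field
    nonempty : 0 < k
    positions-fit : a + k ≤ length s
    values-fit : b + k ≤ length s
    image-inside : ∀ j → j < k → b ≤ nth s (a + j) × nth s (a + j) < b + k
    preimage-inside : ∀ i → i < length s → b ≤ nth s i → nth s i < b + k → a ≤ i × i < a + k
open Block public

abstract
  ⋆-block : ∀ τ α (vτ : IsMPerm τ) (vα : IsMPerm α) → Block (vals (τ ⋆ α)) (mark τ) (length (vals α)) (nth (vals τ) (mark τ))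
  ⋆-block τ α vτ vα = mkBlock (subst (0 <_) (sym ek) (s≤s z≤n)) ak' bk' block-image bw
    where
    open Inflation τ α vτ vα
    le : ∀ x → x < length t → x + k ≤ length s
    le x q = subst (x + k ≤_) (sym length≡) (subst (λ z → x + z ≤ length t + m) (sym ek) (subst (_≤ length t + m) (sym (+-suc x m)) (+-monoˡ-≤ m q)))
    ak' : a + k ≤ length s
    ak' = le a a<t
    bk' : b + k ≤ length s
    bk' = le b b<t
    bw : ∀ i → i < length s → b ≤ nth s i → nth s i < b + k → a ≤ i × i < a + k
    bw i q x y with block-preimage i q x y
    ... | j , jk , refl = m≤m+n a j , +-monoʳ-< a jk

unshiftV : ℕ → ℕ → ℕ → ℕ
unshiftV b m x with x <? b
... | yes _ = x
... | no _ = x ∸ m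

unshiftV-lt : ∀ {b m x} → x < b → unshiftV b m x ≡ x
unshiftV-lt {b} {m} {x} p with x <? b
... | yes _ = refl
... | no np = ⊥-elim (np p)

unshiftV-ge : ∀ {b m x} → b ≤ x → unshiftV b m x ≡ x ∸ m
unshiftV-ge {b} {m} {x} p with x <? b
... | yes q = ⊥-elim (<⇒≱ q p)
... | no _ = refl

outerVals : List ℕ → ℕ → ℕ → ℕ → ℕ → ℕ
outerVals s a b m i with <-cmp i a
... | tri< _ _ _ = unshiftV b m (nth s i)
... | tri≈ _ _ _ = b
... | tri> _ _ _ = unshiftV b m (nth s (i + m))

outerVals-lt : ∀ s a b m i → i < a → outerVals s a b m i ≡ unshiftV b m (nth s i)
outerVals-lt s a b m i p with <-cmp i a
... | tri< _ _ _ = refl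
... | tri≈ x _ _ = ⊥-elim (x p)
... | tri> x _ _ = ⊥-elim (x p)

outerVals-eq : ∀ s a b m → outerVals s a b m a ≡ b
outerVals-eq s a b m with <-cmp a a
... | tri< _ x _ = ⊥-elim (x refl)
... | tri≈ _ _ _ = refl
... | tri> _ x _ = ⊥-elim (x refl)

outerVals-gt : ∀ s a b m i → a < i → outerVals s a b m i ≡ unshiftV b m (nth s (i + m))
outerVals-gt s a b m i p with <-cmp i a
... | tri< _ _ x = ⊥-elim (x p)
... | tri≈ _ _ x = ⊥-elim (x p)
... | tri> _ _ _ = refl

x+sm≤⇒ : ∀ x m n → x + suc m ≤ n → x < n ∸ m
x+sm≤⇒ x m n h = m+n≤o⇒m≤o∸n (suc x) (subst (_≤ n) (+-suc x m) h)

record FactorisationAt (s : List ℕ) (M a k b : ℕ) : Set where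
  constructor factorisationAt
  field
    outer inner : MPerm
    outer-isMPerm : IsMPerm outer
    inner-isMPerm : IsMPerm inner
    ⋆-≡ : outer ⋆ inner ≡ s at M
    outer-mark : mark outer ≡ a
    inner-length : length (vals inner) ≡ k
    outer-value : nth (vals outer) (mark outer) ≡ b

-- α is the block read relative to its least value b; τ collapses the block
-- to the single position a (value b), undoing the shift of the values above it.
module Factorisation (s : List ℕ) (M : ℕ) (vs : IsPermutation s) (a m b : ℕ) (W : Block s a (suc m) b) (aM : a ≤ M) (Mk : M < a + suc m) where
  n = length s
  k = suc m
  fα : ℕ → ℕ
  fα j = nth s (a + j) ∸ b
  αv = applyUpTo fα k
  α = αv at (M ∸ a)
  n' = n ∸ m
  τv = applyUpTo (outerVals s a b m) n'
  τ = τv at a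

  m≤n : m ≤ n
  m≤n = ≤-trans (m≤n+m m (suc a)) (≤-trans (≤-reflexive (sym (+-suc a m))) (positions-fit W))
  a<n' : a < n'
  a<n' = x+sm≤⇒ a m n (positions-fit W)
  b<n' : b < n'
  b<n' = x+sm≤⇒ b m n (values-fit W)

  Out : ℕ → Set
  Out x = x < b ⊎ b + k ≤ x

  outW : ∀ i → i < n → (i < a ⊎ a + k ≤ i) → Out (nth s i)
  outW i q h with nth s i <? b
  ... | yes lt = inj₁ lt
  ... | no nlt with b + k ≤? nth s i
  ... | yes ge = inj₂ ge
  ... | no nge with preimage-inside W i q (≮⇒≥ nlt) (≰⇒> nge) | h
  ...   | (u , v) | inj₁ lt = ⊥-elim (<⇒≱ lt u)
  ...   | (u , v) | inj₂ ge = ⊥-elim (<⇒≱ v ge)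

  sh-unsh : ∀ {x} → Out x → shiftV b m (unshiftV b m x) ≡ x
  sh-unsh (inj₁ lt) = trans (cong (shiftV b m) (unshiftV-lt lt)) (shiftV-lt lt)
  sh-unsh {x} (inj₂ ge) = trans (cong (shiftV b m) (unshiftV-ge (≤-trans (m≤m+n b k) ge)))
     (trans (shiftV-ge (m+n≤o⇒m≤o∸n b (≤-trans (+-monoʳ-≤ b (n≤1+n m)) ge))) (m∸n+n≡m (≤-trans (m≤n+m m (suc b)) (subst (_≤ x) (+-suc b m) ge))))

  unsh-ne : ∀ {x} → Out x → ¬ unshiftV b m x ≡ b
  unsh-ne {x} o e = out-self (subst Out e' o)
    where
    e' : x ≡ b + m
    e' = trans (sym (sh-unsh o)) (trans (cong (shiftV b m) e) (shiftV-ge {b} {m} ≤-refl))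
    out-self : Out (b + m) → ⊥
    out-self (inj₁ lt) = <⇒≱ lt (m≤m+n b m)
    out-self (inj₂ ge) = <⇒≱ (+-monoʳ-< b (n<1+n m)) ge

  unsh-inj : ∀ {x y} → Out x → Out y → unshiftV b m x ≡ unshiftV b m y → x ≡ y
  unsh-inj ox oy e = trans (sym (sh-unsh ox)) (trans (cong (shiftV b m) e) (sh-unsh oy))

  unsh-bnd : ∀ {x} → x < n → Out x → unshiftV b m x < n'
  unsh-bnd {x} q (inj₁ lt) = subst (_< n') (sym (unshiftV-lt lt)) (<-trans lt b<n')
  unsh-bnd {x} q (inj₂ ge) = subst (_< n') (sym (unshiftV-ge (≤-trans (m≤m+n b k) ge))) (∸-monoˡ-< q (≤-trans (m≤n+m m (suc b)) (subst (_≤ x) (+-suc b m) ge)))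

  i+m<n : ∀ i → i < n' → i + m < n
  i+m<n i q = subst (i + m <_) (m∸n+n≡m m≤n) (+-monoˡ-< m q)

  outLo : ∀ i → i < a → Out (nth s i)
  outLo i lt = outW i (<-trans lt (<-≤-trans (m<m+n a (s≤s z≤n)) (positions-fit W))) (inj₁ lt)
  outHi : ∀ i → a < i → i < n' → Out (nth s (i + m))
  outHi i gt q = outW (i + m) (i+m<n i q) (inj₂ (subst (_≤ i + m) (sym (+-suc a m)) (+-monoˡ-≤ m gt)))

  τlen : length τv ≡ n'
  τlen = length-applyUpTo (outerVals s a b m) n'
  αlen : length αv ≡ k
  αlen = length-applyUpTo fα k

  τi : ∀ i → i < n' → nth τv i ≡ outerVals s a b m i
  τi i q = nth-applyUpTo (outerVals s a b m) n' i q

  vτ : IsMPerm τ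
  vτ = isPermutation bd ij , subst (a <_) (sym τlen) a<n'
    where
    bd : ∀ {i} → i < length τv → nth τv i < length τv
    bd {i} q' with subst (i <_) τlen q'
    ... | q rewrite τlen | τi i q with <-cmp i a
    ... | tri< lt _ _ = unsh-bnd {nth s i} (nth-< vs (<-≤-trans (<-trans lt a<n') (m∸n≤m n m))) (outLo i lt)
    ... | tri≈ _ refl _ = b<n'
    ... | tri> _ _ gt = unsh-bnd {nth s (i + m)} (nth-< vs (i+m<n i q)) (outHi i gt q)
    ij : ∀ {i j} → i < length τv → j < length τv → nth τv i ≡ nth τv j → i ≡ j
    ij {i} {j} qi' qj' e with subst (i <_) τlen qi' | subst (j <_) τlen qj'
    ... | qi | qj rewrite τi i qi | τi j qj with <-cmp i a | <-cmp j a
    ... | tri≈ _ refl _ | tri≈ _ refl _ = refl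
    ... | tri< lt _ _ | tri< lt' _ _ =
          nth-injective vs (<-trans lt (<-≤-trans (m<m+n a (s≤s z≤n)) (positions-fit W))) (<-trans lt' (<-≤-trans (m<m+n a (s≤s z≤n)) (positions-fit W))) (unsh-inj (outLo i lt) (outLo j lt') e)
    ... | tri> _ _ gt | tri> _ _ gt' =
          +-cancelʳ-≡ m i j (nth-injective vs (i+m<n i qi) (i+m<n j qj) (unsh-inj (outHi i gt qi) (outHi j gt' qj) e))
    ... | tri< lt _ _ | tri> _ _ gt' =
          ⊥-elim (<⇒≱ (<-≤-trans lt (≤-trans (<⇒≤ gt') (m≤m+n j m))) (≤-reflexive (sym (nth-injective vs (<-trans lt (<-≤-trans (m<m+n a (s≤s z≤n)) (positions-fit W))) (i+m<n j qj) (unsh-inj (outLo i lt) (outHi j gt' qj) e)))))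
    ... | tri> _ _ gt | tri< lt' _ _ =
          ⊥-elim (<⇒≱ (<-≤-trans lt' (≤-trans (<⇒≤ gt) (m≤m+n i m))) (≤-reflexive (nth-injective vs (i+m<n i qi) (<-trans lt' (<-≤-trans (m<m+n a (s≤s z≤n)) (positions-fit W))) (unsh-inj (outHi i gt qi) (outLo j lt') e))))
    ... | tri≈ _ refl _ | tri< lt' _ _ = ⊥-elim (unsh-ne (outLo j lt') (sym e))
    ... | tri≈ _ refl _ | tri> _ _ gt' = ⊥-elim (unsh-ne (outHi j gt' qj) (sym e))
    ... | tri< lt _ _ | tri≈ _ refl _ = ⊥-elim (unsh-ne (outLo i lt) e)
    ... | tri> _ _ gt | tri≈ _ refl _ = ⊥-elim (unsh-ne (outHi i gt qi) e)

  vα : IsMPerm α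
  vα = isPermutation bd ij , subst (M ∸ a <_) (sym αlen) (m<n+o⇒m∸n<o M a Mk)
    where
    αi : ∀ j → j < k → nth αv j ≡ fα j
    αi j q = nth-applyUpTo fα k j q
    bd : ∀ {j} → j < length αv → nth αv j < length αv
    bd {j} q' with subst (j <_) αlen q'
    ... | q rewrite αlen | αi j q = m<n+o⇒m∸n<o (nth s (a + j)) b (proj₂ (image-inside W j q))
    ij : ∀ {i j} → i < length αv → j < length αv → nth αv i ≡ nth αv j → i ≡ j
    ij {i} {j} qi' qj' e with subst (i <_) αlen qi' | subst (j <_) αlen qj'
    ... | qi | qj rewrite αi i qi | αi j qj =
      +-cancelˡ-≡ a i j (nth-injective vs (<-≤-trans (+-monoʳ-< a qi) (positions-fit W)) (<-≤-trans (+-monoʳ-< a qj) (positions-fit W))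
        (∸-cancelʳ-≡ (proj₁ (image-inside W i qi)) (proj₁ (image-inside W j qj)) e))

  module I = Inflation τ α vτ vα
  eb : I.b ≡ b
  eb = trans (τi a a<n') (outerVals-eq s a b m)
  em : I.m ≡ m
  em = cong (_∸ 1) αlen

  lenI : length I.s ≡ n
  lenI = trans I.length≡ (trans (cong₂ _+_ τlen em) (m∸n+n≡m m≤n))

  eqn : τ ⋆ α ≡ s at M
  eqn = cong₂ _at_ (nth-ext I.s s lenI pw) (m+[n∸m]≡n aM)
    where
    shc : ∀ x → shiftV I.b I.m x ≡ shiftV b m x
    shc x = cong₂ (λ u v → shiftV u v x) eb em
    pw : ∀ i → i < length I.s → nth I.s i ≡ nth s i
    pw i q with I.position-view i q
    ... | inj₁ lt = trans (I.before i lt) (trans (shc _) (trans (cong (shiftV b m) (trans (τi i (<-trans lt a<n')) (outerVals-lt s a b m i lt))) (sh-unsh (outLo i lt))))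
    ... | inj₂ (inj₁ (j , jk , refl)) = trans (I.inside j jk) (trans (cong₂ _+_ eb (nth-applyUpTo fα k j (subst (j <_) αlen jk))) (m+[n∸m]≡n (proj₁ (image-inside W j (subst (j <_) αlen jk)))))
    ... | inj₂ (inj₂ (i' , u , v , refl)) = trans (I.after i' u v) (trans (shc _) 
        (trans (cong (shiftV b m) (trans (τi i' (subst (i' <_) τlen v)) (outerVals-gt s a b m i' u))) (trans (sh-unsh (outHi i' u (subst (i' <_) τlen v))) (cong (λ z → nth s (i' + z)) (sym em)))))

abstract
  block⇒factorisation : ∀ s M → IsPermutation s → ∀ a k b → Block s a k b → a ≤ M → M < a + k → FactorisationAt s M a k b
  block⇒factorisation s M vs a (suc m) b W aM Mk = factorisationAt F.τ F.α F.vτ F.vα F.eqn refl F.αlen F.eb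
    where
    module F = Factorisation s M vs a m b W aM Mk
  block⇒factorisation s M vs a zero b W aM Mk = ⊥-elim (<-irrefl refl (nonempty W))

block-min : ∀ {s a k b} → IsPermutation s → Block s a k b → Σ ℕ λ i → (a ≤ i × i < a + k) × nth s i ≡ b
block-min {s} {a} {k} {b} v W with nth-surjective v (<-≤-trans (m<m+n b (nonempty W)) (values-fit W))
... | i , q , e = i , preimage-inside W i q (≤-reflexive (sym e)) (subst (_< b + k) (sym e) (m<m+n b (nonempty W))) , e

block-max : ∀ {s a m b} → IsPermutation s → Block s a (suc m) b → Σ ℕ λ i → (a ≤ i × i < a + suc m) × nth s i ≡ b + m
block-max {s} {a} {m} {b} v W with nth-surjective v (<-≤-trans (+-monoʳ-< b (n<1+n m)) (values-fit W))
... | i , q , e = i , preimage-inside W i q (subst (b ≤_) (sym e) (m≤m+n b m)) (subst (_< b + suc m) (sym e) (+-monoʳ-< b (n<1+n m))) , e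

image-inside′ : ∀ {s a k b} → Block s a k b → ∀ i → a ≤ i → i < a + k → b ≤ nth s i × nth s i < b + k
image-inside′ {s} {a} {k} {b} W i u v with split≤ u
... | j , refl = image-inside W j (+-cancelˡ-< a j k v)

module Restriction (O I : MPerm) (vO : IsMPerm O) (vI : IsMPerm I) (vs : IsPermutation (vals (O ⋆ I)))
  (m da db : ℕ) (W : Block (vals (O ⋆ I)) (mark O + da) (suc m) (nth (vals O) (mark O) + db))
  (inside : mark O + da + suc m ≤ mark O + length (vals I)) where
  module I = Inflation O I vO vI
  W' = ⋆-block O I vO vI
  a = I.a
  b = I.b
  k = I.k

  le1 : da + suc m ≤ k
  le1 = +-cancelˡ-≤ a (da + suc m) k (subst (_≤ a + k) (+-assoc a da (suc m)) inside)

  inW' : ∀ i → a + da ≤ i → i < a + da + suc m → a ≤ i × i < a + k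
  inW' i u v = ≤-trans (m≤m+n a da) u , <-≤-trans v inside

  bk' : db + suc m ≤ k
  bk' with block-max vs W
  ... | i , (u , v) , e with inW' i u v
  ... | x , y = +-cancelˡ-≤ b (db + suc m) k (subst (_≤ b + k) eqn (proj₂ (image-inside′ W' i x y)))
    where
    eqn : suc (nth I.s i) ≡ b + (db + suc m)
    eqn = trans (cong suc e) (trans (sym (+-suc (b + db) m)) (+-assoc b db (suc m)))

  fw : ∀ j → j < suc m → db ≤ nth I.p (da + j) × nth I.p (da + j) < db + suc m
  fw j q with image-inside W j q
  ... | u , v = +-cancelˡ-≤ b db _ (subst (b + db ≤_) e u) , +-cancelˡ-< b _ (db + suc m) (subst (_< b + (db + suc m)) e (subst (nth I.s (a + da + j) <_) (+-assoc b db (suc m)) v))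
    where
    dj< : da + j < k
    dj< = <-≤-trans (+-monoʳ-< da q) le1
    e : nth I.s (a + da + j) ≡ b + nth I.p (da + j)
    e = trans (cong (nth I.s) (+-assoc a da j)) (I.inside (da + j) dj<)

  bw : ∀ i → i < length I.p → db ≤ nth I.p i → nth I.p i < db + suc m → da ≤ i × i < da + suc m
  bw i q u v with preimage-inside W (a + i) (<-≤-trans (+-monoʳ-< a q) (positions-fit W')) (subst (b + db ≤_) (sym (I.inside i q)) (+-monoʳ-≤ b u))
                    (subst (_< b + db + suc m) (sym (I.inside i q)) (subst (b + nth I.p i <_) (sym (+-assoc b db (suc m))) (+-monoʳ-< b v)))
  ... | x , y = +-cancelˡ-≤ a da i x , +-cancelˡ-< a i (da + suc m) (subst (a + i <_) (+-assoc a da (suc m)) y)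

  abstract
    restricted-block : Block I.p da (suc m) db
    restricted-block = mkBlock (s≤s z≤n) le1 bk' fw bw

IsMPerm⇒Valid : ∀ {σ} → IsMPerm σ → ValidMPerm σ
IsMPerm⇒Valid {σ} (v , q) = IsPermutation⇒↭upTo (vals σ) v , q

Valid⇒IsMPerm : ∀ {σ} → ValidMPerm σ → IsMPerm σ
Valid⇒IsMPerm {σ} (v , q) = ↭upTo⇒IsPermutation (vals σ) v , q

length≡1⇒bar1 : ∀ {σ} → IsMPerm σ → length (vals σ) ≡ 1 → σ ≡ bar1
length≡1⇒bar1 {(x ∷ []) at zero} (v , q) e with nth-< v {0} (s≤s z≤n)
... | s≤s z≤n = refl
length≡1⇒bar1 {(x ∷ []) at suc c} (v , s≤s ()) e
length≡1⇒bar1 {[] at c} (v , ()) e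
length≡1⇒bar1 {(x ∷ y ∷ l) at c} (v , q) ()

≢bar1⇒2≤length : ∀ {σ} → IsMPerm σ → ¬ σ ≡ bar1 → 2 ≤ length (vals σ)
≢bar1⇒2≤length {[] at c} (v , ()) ne
≢bar1⇒2≤length {(x ∷ []) at c} v ne = ⊥-elim (ne (length≡1⇒bar1 v refl))
≢bar1⇒2≤length {(x ∷ y ∷ l) at c} v ne = s≤s (s≤s z≤n)

Block-resp : ∀ {s s' a a' k k' b b'} → s ≡ s' → a ≡ a' → k ≡ k' → b ≡ b' → Block s a k b → Block s' a' k' b'
Block-resp refl refl refl refl W = W

HasOnlyTrivialFactorisations : MPerm → Set
HasOnlyTrivialFactorisations ξ = ∀ τ₁ τ₂ → ValidMPerm τ₁ → ValidMPerm τ₂ → τ₁ ⋆ τ₂ ≡ ξ → (τ₁ ≡ bar1) ⊎ (τ₂ ≡ bar1)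

-- An interval W′ of ξ ⋆ α that contains the interval of α and starts no later:
-- restricting W′ to ξ factors ξ = O ⋆ X′, so irreducibility of ξ leaves only
-- W′ = the interval of α, or W′ = everything.
module Nested (ξ α : MPerm) (vξ : IsMPerm ξ) (vα : IsMPerm α) (irr : HasOnlyTrivialFactorisations ξ) (vs : IsPermutation (vals (ξ ⋆ α)))
  (a' k' b' : ℕ) (W' : Block (vals (ξ ⋆ α)) a' k' b') (a'≤a : a' ≤ mark ξ) (inside : mark ξ + length (vals α) ≤ a' + k') where
  module X = Inflation ξ α vξ vα
  σ = ξ ⋆ α
  s = vals σ
  M = mark σ
  W1 = ⋆-block ξ α vξ vα

  a'≤M : a' ≤ M
  a'≤M = ≤-trans a'≤a (m≤m+n X.a X.c)
  M<e : M < a' + k'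
  M<e = <-≤-trans (+-monoʳ-< X.a (proj₂ vα)) inside

  abstract
    dichotomy : (a' ≡ mark ξ × k' ≡ length (vals α)) ⊎ (a' ≡ 0 × k' ≡ length s)
    dichotomy with block⇒factorisation s M vs a' k' b' W' a'≤M M<e
    ... | factorisationAt O I vO vI eOI refl refl refl with split≤ a'≤a | block-min vs W1
    ... | da , eda | i , (u , v) , ei with image-inside′ W' i (≤-trans a'≤a u) (<-≤-trans v inside)
    ... | (bu , _) with split≤ (subst (nth (vals O) (mark O) ≤_) ei bu) | X.ek
    ... | db , edb | ekα with Restriction.restricted-block O I vO vI vs-OI X.m da db W-OI inside-OI
      where
      eσ : vals (O ⋆ I) ≡ s
      eσ = cong vals eOI
      vs-OI : IsPermutation (vals (O ⋆ I))
      vs-OI = subst IsPermutation (sym eσ) vs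
      W-OI : Block (vals (O ⋆ I)) (mark O + da) (suc X.m) (nth (vals O) (mark O) + db)
      W-OI = Block-resp (sym eσ) eda ekα edb W1
      inside-OI : mark O + da + suc X.m ≤ mark O + length (vals I)
      inside-OI = subst₂ (λ u v → u + v ≤ mark O + length (vals I)) eda ekα inside
    ... | W-inner with block⇒factorisation (vals I) (mark I) (proj₁ vI) da (suc X.m) db W-inner da≤ <e
      where
      eM : mark O + mark I ≡ M
      eM = cong mark eOI
      da≤ : da ≤ mark I
      da≤ = +-cancelˡ-≤ (mark O) da (mark I) (subst₂ _≤_ eda (sym eM) (m≤m+n X.a X.c))
      <e : mark I < da + suc X.m
      <e = +-cancelˡ-< (mark O) (mark I) (da + suc X.m) (subst₂ _<_ (sym eM) (trans (cong₂ _+_ eda ekα) (+-assoc (mark O) da (suc X.m))) (+-monoʳ-< X.a (proj₂ vα)))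
    ... | factorisationAt X′ Y vX vY eXY refl eY _ with irr O X′ (IsMPerm⇒Valid vO) (IsMPerm⇒Valid vX) (proj₁ canc)
      where
      vOX : IsMPerm (O ⋆ X′)
      vOX = Inflation.isMPerm O X′ vO vX
      eq : (O ⋆ X′) ⋆ Y ≡ ξ ⋆ α
      eq = trans (Associativity.⋆-assoc O X′ Y vO vX vY) (trans (cong (O ⋆_) eXY) eOI)
      canc : O ⋆ X′ ≡ ξ × Y ≡ α
      canc = ⋆-cancel (O ⋆ X′) Y ξ α vOX vY vξ vα eq (sym eda) (trans eY (sym ekα))
    ... | inj₁ refl = inj₂ (refl , sym (trans (sym (cong length (cong vals eOI))) (trans (Inflation.length≡ O I vO vI) (sym (Inflation.ek O I vO vI)))))
    ... | inj₂ refl = inj₁ (sym (trans eda (+-identityʳ (mark O))) , trans (cong length (sym (cong vals eXY))) (trans (Inflation.length≡ bar1 Y vX vY) (trans (sym (Inflation.ek bar1 Y vX vY)) (trans eY (sym ekα)))))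

-- Sums with 1̄

ValidPerm⇒All< : ∀ {A : List ℕ} → ValidPerm A → All (_< length A) A
ValidPerm⇒All< p = All.tabulate (λ m → ∈-upTo⁻ (∈-resp-↭ p m))

map-shiftV-below : ∀ {b m} (l : List ℕ) → All (_< b) l → map (shiftV b m) l ≡ l
map-shiftV-below l a = map-id-local (All.map shiftV-lt a)

upTo-suc : ∀ n → upTo (suc n) ≡ 0 ∷ map suc (upTo n)
upTo-suc n = cong (0 ∷_) (sym (map-upTo suc n))

bar1⊕-valid : ∀ {τ} → ValidPerm τ → ValidMPerm (bar1⊕ τ)
bar1⊕-valid {τ} p = subst (λ z → 0 ∷ map suc τ ↭ upTo (suc z)) (sym (length-map suc τ))
  (subst (0 ∷ map suc τ ↭_) (sym (upTo-suc (length τ))) (↭-prep 0 (map⁺ suc p))) , s≤s z≤n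

⊕bar1-valid : ∀ {τ} → ValidPerm τ → ValidMPerm (τ ⊕bar1)
⊕bar1-valid {τ} p = subst (λ z → τ ++ [ length τ + 0 ] ↭ upTo z) (sym len)
  (subst (λ z → τ ++ [ z ] ↭ upTo (suc (length τ))) (sym (+-identityʳ (length τ)))
    (subst (τ ++ [ length τ ] ↭_) (upTo-∷ʳ (length τ)) (++⁺ʳ [ length τ ] p))) , bnd'
  where
  len : length (τ ++ [ length τ + 0 ]) ≡ suc (length τ)
  len = trans (length-++ τ) (+-comm (length τ) 1)
  bnd' : length τ < length (τ ++ [ length τ + 0 ])
  bnd' = subst (length τ <_) (sym len) (n<1+n _)

bar1⊖-valid : ∀ {π} → ValidPerm π → ValidMPerm (bar1⊖ π)
bar1⊖-valid {π} p = subst (λ z → z ∷ π ↭ upTo (suc (length π))) (sym (+-identityʳ (length π)))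
    (↭-trans (++-comm [ length π ] π) (subst (π ++ [ length π ] ↭_) (upTo-∷ʳ (length π)) (++⁺ʳ [ length π ] p))) , s≤s z≤n

⊖bar1-valid : ∀ {π} → ValidPerm π → ValidMPerm (π ⊖bar1)
⊖bar1-valid {π} p = subst (λ z → map suc π ++ [ 0 ] ↭ upTo z) (sym len)
   (↭-trans (++-comm (map suc π) [ 0 ]) (subst (0 ∷ map suc π ↭_) (sym (upTo-suc (length π))) (↭-prep 0 (map⁺ suc p)))) , bnd'
  where
  len : length (map suc π ++ [ 0 ]) ≡ suc (length π)
  len = trans (length-++ (map suc π)) (trans (cong (_+ 1) (length-map suc π)) (+-comm (length π) 1))
  bnd' : length π < length (map suc π ++ [ 0 ])
  bnd' = subst (length π <_) (sym len) (n<1+n _)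

inflVals-++ : ∀ (l1 : List ℕ) x l2 a b m p → length l1 ≡ a →
  inflVals (l1 ++ x ∷ l2) a b m p ≡ map (shiftV b m) l1 ++ map (b +_) p ++ map (shiftV b m) l2
inflVals-++ [] x l2 .0 b m p refl = refl
inflVals-++ (y ∷ l1) x l2 .(suc (length l1)) b m p refl = cong (shiftV b m y ∷_) (inflVals-++ l1 x l2 (length l1) b m p refl)

nth-∷ʳ : ∀ (l : List ℕ) x → nth (l ++ [ x ]) (length l) ≡ x
nth-∷ʳ [] x = refl
nth-∷ʳ (y ∷ l) x = nth-∷ʳ l x

length-∷ʳ : ∀ (l : List ℕ) x → length (l ++ [ x ]) ≡ suc (length l)
length-∷ʳ [] x = refl
length-∷ʳ (y ∷ l) x = cong suc (length-∷ʳ l x)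

-- A ⊕ 1 ⊕ B marked at the middle entry (and dually A ⊖ 1 ⊖ B): the common
-- value of the two products of a commuting pair.
⊕-cross : List ℕ → List ℕ → MPerm
⊕-cross A B = (A ++ length A ∷ map (λ y → suc (length A + y)) B) at length A

⊖-cross : List ℕ → List ℕ → MPerm
⊖-cross A B = (map (λ y → suc (length B + y)) A ++ length B ∷ B) at length A

bar1⊕⋆⊕bar1 : ∀ A B → (bar1⊕ B) ⋆ (A ⊕bar1) ≡ ⊕-cross A B
bar1⊕⋆⊕bar1 A B = cong₂ _at_ vq refl
  where
  m = length (A ++ [ length A + 0 ]) ∸ 1
  em : m ≡ length A
  em = cong (_∸ 1) (length-∷ʳ A _)
  vq : map (0 +_) (A ++ [ length A + 0 ]) ++ map (shiftV 0 m) (map suc B) ≡ A ++ length A ∷ map (λ y → suc (length A + y)) B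
  vq = trans (cong₂ _++_ (map-id _) (trans (sym (map-∘ B)) (map-cong (λ y → trans (cong (suc y +_) em) (cong suc (+-comm y (length A)))) B)))
     (trans (++-assoc A _ _) (cong (λ z → A ++ z ∷ map (λ y → suc (length A + y)) B) (+-identityʳ (length A))))

⊕bar1⋆bar1⊕ : ∀ A B → ValidPerm A → (A ⊕bar1) ⋆ (bar1⊕ B) ≡ ⊕-cross A B
⊕bar1⋆bar1⊕ A B vA = cong₂ _at_ vq (+-identityʳ (length A))
  where
  m = length (map suc B)
  eb : nth (A ++ [ length A + 0 ]) (length A) ≡ length A
  eb = trans (nth-∷ʳ A _) (+-identityʳ _)
  vq : inflVals (A ++ [ length A + 0 ]) (length A) (nth (A ++ [ length A + 0 ]) (length A)) m (0 ∷ map suc B) ≡ A ++ length A ∷ map (λ y → suc (length A + y)) B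
  vq rewrite eb = trans (inflVals-++ A (length A + 0) [] (length A) (length A) m (0 ∷ map suc B) refl)
     (cong₂ _++_ (map-shiftV-below A (ValidPerm⇒All< vA)) (cong₂ _∷_ (+-identityʳ _) (trans (++-identityʳ _) (trans (sym (map-∘ B)) (map-cong (λ y → +-suc (length A) y) B)))))

bar1⊖⋆⊖bar1 : ∀ A B → ValidPerm B → (bar1⊖ B) ⋆ (A ⊖bar1) ≡ ⊖-cross A B
bar1⊖⋆⊖bar1 A B vB = cong₂ _at_ vq refl
  where
  b = length B + 0
  m = length (map suc A ++ [ 0 ]) ∸ 1
  allB : All (_< b) B
  allB = All.map (λ q → subst (_ <_) (sym (+-identityʳ _)) q) (ValidPerm⇒All< vB)
  vq : map (b +_) (map suc A ++ [ 0 ]) ++ map (shiftV b m) B ≡ map (λ y → suc (length B + y)) A ++ length B ∷ B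
  vq = trans (cong₂ _++_ (map-++ (b +_) (map suc A) [ 0 ]) (map-shiftV-below B allB))
      (trans (++-assoc (map (b +_) (map suc A)) _ _)
      (cong₂ _++_ (trans (sym (map-∘ A)) (map-cong (λ y → trans (cong (_+ suc y) (+-identityʳ _)) (+-suc (length B) y)) A))
                  (cong (_∷ B) (trans (+-identityʳ _) (+-identityʳ _)))))

⊖bar1⋆bar1⊖ : ∀ A B → (A ⊖bar1) ⋆ (bar1⊖ B) ≡ ⊖-cross A B
⊖bar1⋆bar1⊖ A B = cong₂ _at_ vq (+-identityʳ (length A))
  where
  m = length B
  eb : nth (map suc A ++ [ 0 ]) (length A) ≡ 0
  eb = trans (cong (nth (map suc A ++ [ 0 ])) (sym (length-map suc A))) (nth-∷ʳ (map suc A) 0)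
  vq : inflVals (map suc A ++ [ 0 ]) (length A) (nth (map suc A ++ [ 0 ]) (length A)) m ((length B + 0) ∷ B) ≡ map (λ y → suc (length B + y)) A ++ length B ∷ B
  vq rewrite eb = trans (inflVals-++ (map suc A) 0 [] (length A) 0 m ((length B + 0) ∷ B) (length-map suc A))
     (cong₂ _++_ (trans (sym (map-∘ A)) (map-cong (λ y → cong suc (+-comm y (length B))) A))
                 (trans (++-identityʳ _) (cong₂ _∷_ (+-identityʳ _) (map-id B))))

++-injective-≡length : ∀ (l1 l1' r r' : List ℕ) → length l1 ≡ length l1' → l1 ++ r ≡ l1' ++ r' → l1 ≡ l1' × r ≡ r'
++-injective-≡length [] [] r r' _ e = refl , e
++-injective-≡length (x ∷ l1) (y ∷ l1') r r' el e with ++-injective-≡length l1 l1' r r' (suc-injective el) (cong tl e)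
  where
  tl : List ℕ → List ℕ
  tl [] = []
  tl (_ ∷ z) = z
... | e1 , e2 = cong₂ _∷_ (cong hd e) e1 , e2
  where
  hd : List ℕ → ℕ
  hd [] = 0
  hd (z ∷ _) = z

⊕-cross-injective : ∀ A B A' B' → ⊕-cross A B ≡ ⊕-cross A' B' → A ≡ A' × B ≡ B'
⊕-cross-injective A B A' B' e with ++-injective-≡length A A' _ _ (cong mark e) (cong vals e)
... | refl , e2 = refl , map-injective (λ {x} {y} q → +-cancelˡ-≡ (length A) x y (suc-injective q)) (cong tl e2)
  where
  tl : List ℕ → List ℕ
  tl [] = []
  tl (_ ∷ z) = z

⊖-cross-injective : ∀ A B A' B' → ⊖-cross A B ≡ ⊖-cross A' B' → A ≡ A' × B ≡ B'
⊖-cross-injective A B A' B' e with ++-injective-≡length (map (λ y → suc (length B + y)) A) (map (λ y → suc (length B' + y)) A') _ _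
   (trans (length-map _ A) (trans (cong mark e) (sym (length-map _ A')))) (cong vals e)
... | e1 , e2 with cong tl e2
  where
  tl : List ℕ → List ℕ
  tl [] = []
  tl (_ ∷ z) = z
... | refl = map-injective (λ {x} {y} q → +-cancelˡ-≡ (length B) x y (suc-injective q)) e1 , refl

Commuting⇒⋆-comm : ∀ x y → Commuting x y → x ⋆ y ≡ y ⋆ x
Commuting⇒⋆-comm x y (inj₁ (τ1 , τ2 , i1 , i2 , inj₁ (refl , refl))) = trans (bar1⊕⋆⊕bar1 τ2 τ1) (sym (⊕bar1⋆bar1⊕ τ2 τ1 (proj₁ i2)))
Commuting⇒⋆-comm x y (inj₁ (τ1 , τ2 , i1 , i2 , inj₂ (refl , refl))) = trans (⊕bar1⋆bar1⊕ τ2 τ1 (proj₁ i2)) (sym (bar1⊕⋆⊕bar1 τ2 τ1))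
Commuting⇒⋆-comm x y (inj₂ (π1 , π2 , i1 , i2 , inj₁ (refl , refl))) = trans (bar1⊖⋆⊖bar1 π2 π1 (proj₁ i1)) (sym (⊖bar1⋆bar1⊖ π2 π1))
Commuting⇒⋆-comm x y (inj₂ (π1 , π2 , i1 , i2 , inj₂ (refl , refl))) = trans (⊖bar1⋆bar1⊖ π2 π1) (sym (bar1⊖⋆⊖bar1 π2 π1 (proj₁ i1)))

bar1⊕⋆bar1⊕ : ∀ τ1 τ2 → (bar1⊕ τ2) ⋆ (bar1⊕ τ1) ≡ bar1⊕ (τ1 ⊕ₚ τ2)
bar1⊕⋆bar1⊕ τ1 τ2 = cong₂ _at_ (cong (0 ∷_) vq) refl
  where
  m = length (map suc τ1)
  vq : map (0 +_) (map suc τ1) ++ map (shiftV 0 m) (map suc τ2) ≡ map suc (τ1 ++ map (length τ1 +_) τ2)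
  vq = trans (cong₂ _++_ (map-id _) (trans (sym (map-∘ τ2)) (trans (map-cong (λ y → trans (cong (suc y +_) (length-map suc τ1)) (cong suc (+-comm y (length τ1)))) τ2) (map-∘ τ2))))
       (sym (map-++ suc τ1 _))

⊕bar1⋆⊕bar1 : ∀ τ1 τ2 → ValidPerm τ1 → (τ1 ⊕bar1) ⋆ (τ2 ⊕bar1) ≡ (τ1 ⊕ₚ τ2) ⊕bar1
⊕bar1⋆⊕bar1 τ1 τ2 v1 = cong₂ _at_ vq (sym ml)
  where
  L1 = length τ1
  L2 = length τ2
  p = τ2 ++ [ L2 + 0 ]
  m = length p ∸ 1
  ml : length (τ1 ⊕ₚ τ2) ≡ L1 + L2
  ml = trans (length-++ τ1) (cong (L1 +_) (length-map _ τ2))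
  eb : nth (τ1 ++ [ L1 + 0 ]) L1 ≡ L1
  eb = trans (nth-∷ʳ τ1 _) (+-identityʳ _)
  vq : inflVals (τ1 ++ [ L1 + 0 ]) L1 (nth (τ1 ++ [ L1 + 0 ]) L1) m p ≡ (τ1 ++ map (L1 +_) τ2) ++ [ length (τ1 ⊕ₚ τ2) + 0 ]
  vq rewrite eb = trans (inflVals-++ τ1 (L1 + 0) [] L1 L1 m p refl)
     (trans (cong₂ _++_ (map-shiftV-below τ1 (ValidPerm⇒All< v1)) (trans (++-identityʳ _) (map-++ (L1 +_) τ2 _)))
     (trans (sym (++-assoc τ1 _ _)) (cong (λ z → (τ1 ++ map (L1 +_) τ2) ++ [ z ]) (trans (cong (L1 +_) (+-identityʳ _)) (trans (sym ml) (sym (+-identityʳ _)))))))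

bar1⊖⋆bar1⊖ : ∀ π1 π2 → ValidPerm π2 → (bar1⊖ π2) ⋆ (bar1⊖ π1) ≡ bar1⊖ (π1 ⊖ₚ π2)
bar1⊖⋆bar1⊖ π1 π2 v2 = cong₂ _at_ (cong₂ _∷_ hd tl) refl
  where
  L1 = length π1
  L2 = length π2
  b = L2 + 0
  m = L1
  ml : length (π1 ⊖ₚ π2) ≡ L1 + L2
  ml = trans (length-++ (map (L2 +_) π1)) (cong (_+ L2) (length-map _ π1))
  allB : All (_< b) π2
  allB = All.map (λ q → subst (_ <_) (sym (+-identityʳ _)) q) (ValidPerm⇒All< v2)
  hd : b + (L1 + 0) ≡ length (π1 ⊖ₚ π2) + 0
  hd = trans (cong₂ _+_ (+-identityʳ L2) (+-identityʳ L1)) (trans (+-comm L2 L1) (trans (sym ml) (sym (+-identityʳ _))))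
  tl : map (b +_) π1 ++ map (shiftV b m) π2 ≡ map (L2 +_) π1 ++ π2
  tl = cong₂ _++_ (map-cong (λ y → cong (_+ y) (+-identityʳ L2)) π1) (map-shiftV-below π2 allB)

⊖bar1⋆⊖bar1 : ∀ π1 π2 → (π1 ⊖bar1) ⋆ (π2 ⊖bar1) ≡ (π1 ⊖ₚ π2) ⊖bar1
⊖bar1⋆⊖bar1 π1 π2 = cong₂ _at_ vq (sym ml)
  where
  L1 = length π1
  L2 = length π2
  p = map suc π2 ++ [ 0 ]
  m = length p ∸ 1
  em : m ≡ L2
  em = trans (cong (_∸ 1) (length-∷ʳ (map suc π2) 0)) (length-map suc π2)
  ml : length (π1 ⊖ₚ π2) ≡ L1 + L2
  ml = trans (length-++ (map (L2 +_) π1)) (cong (_+ L2) (length-map _ π1))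
  eb : nth (map suc π1 ++ [ 0 ]) L1 ≡ 0
  eb = trans (cong (nth (map suc π1 ++ [ 0 ])) (sym (length-map suc π1))) (nth-∷ʳ (map suc π1) 0)
  vq : inflVals (map suc π1 ++ [ 0 ]) L1 (nth (map suc π1 ++ [ 0 ]) L1) m p ≡ map suc (map (L2 +_) π1 ++ π2) ++ [ 0 ]
  vq rewrite eb = trans (inflVals-++ (map suc π1) 0 [] L1 0 m p (length-map suc π1))
     (trans (cong₂ _++_ (trans (sym (map-∘ π1)) (trans (map-cong (λ y → trans (cong (suc y +_) em) (cong suc (+-comm y L2))) π1) (map-∘ π1))) (trans (++-identityʳ _) (map-id p)))
     (trans (sym (++-assoc (map suc (map (L2 +_) π1)) (map suc π2) [ 0 ])) (cong (_++ [ 0 ]) (sym (map-++ suc (map (L2 +_) π1) π2)))))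

bar1⊕≡bar1⇒[] : ∀ {τ} → bar1⊕ τ ≡ bar1 → τ ≡ []
bar1⊕≡bar1⇒[] {[]} _ = refl
bar1⊕≡bar1⇒[] {x ∷ τ} ()

⊕bar1≡bar1⇒[] : ∀ {τ} → τ ⊕bar1 ≡ bar1 → τ ≡ []
⊕bar1≡bar1⇒[] {[]} _ = refl
⊕bar1≡bar1⇒[] {x ∷ []} ()
⊕bar1≡bar1⇒[] {x ∷ y ∷ τ} ()

bar1⊖≡bar1⇒[] : ∀ {π} → bar1⊖ π ≡ bar1 → π ≡ []
bar1⊖≡bar1⇒[] {[]} _ = refl
bar1⊖≡bar1⇒[] {x ∷ π} ()

⊖bar1≡bar1⇒[] : ∀ {π} → π ⊖bar1 ≡ bar1 → π ≡ []
⊖bar1≡bar1⇒[] {[]} _ = refl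
⊖bar1≡bar1⇒[] {x ∷ []} ()
⊖bar1≡bar1⇒[] {x ∷ y ∷ π} ()

bar1⊕-indecomposable : ∀ τ → ValidPerm τ → ¬ (bar1⊕ τ ≡ bar1) → HasOnlyTrivialFactorisations (bar1⊕ τ) → ⊕-Indecomposable τ
bar1⊕-indecomposable τ v ne irr = v , (λ e → ne (cong bar1⊕_ e)) , λ { (τ1 , τ2 , v1 , v2 , n1 , n2 , e) →
  [ (λ e' → n2 (bar1⊕≡bar1⇒[] e')) , (λ e' → n1 (bar1⊕≡bar1⇒[] e')) ]′ (irr (bar1⊕ τ2) (bar1⊕ τ1) (bar1⊕-valid v2) (bar1⊕-valid v1) (trans (bar1⊕⋆bar1⊕ τ1 τ2) (cong bar1⊕_ e))) }

⊕bar1-indecomposable : ∀ τ → ValidPerm τ → ¬ (τ ⊕bar1 ≡ bar1) → HasOnlyTrivialFactorisations (τ ⊕bar1) → ⊕-Indecomposable τ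
⊕bar1-indecomposable τ v ne irr = v , (λ e → ne (cong _⊕bar1 e)) , λ { (τ1 , τ2 , v1 , v2 , n1 , n2 , e) →
  [ (λ e' → n1 (⊕bar1≡bar1⇒[] e')) , (λ e' → n2 (⊕bar1≡bar1⇒[] e')) ]′ (irr (τ1 ⊕bar1) (τ2 ⊕bar1) (⊕bar1-valid v1) (⊕bar1-valid v2) (trans (⊕bar1⋆⊕bar1 τ1 τ2 v1) (cong _⊕bar1 e))) }

bar1⊖-indecomposable : ∀ π → ValidPerm π → ¬ (bar1⊖ π ≡ bar1) → HasOnlyTrivialFactorisations (bar1⊖ π) → ⊖-Indecomposable π
bar1⊖-indecomposable π v ne irr = v , (λ e → ne (cong bar1⊖_ e)) , λ { (π1 , π2 , v1 , v2 , n1 , n2 , e) →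
  [ (λ e' → n2 (bar1⊖≡bar1⇒[] e')) , (λ e' → n1 (bar1⊖≡bar1⇒[] e')) ]′ (irr (bar1⊖ π2) (bar1⊖ π1) (bar1⊖-valid v2) (bar1⊖-valid v1) (trans (bar1⊖⋆bar1⊖ π1 π2 v2) (cong bar1⊖_ e))) }

⊖bar1-indecomposable : ∀ π → ValidPerm π → ¬ (π ⊖bar1 ≡ bar1) → HasOnlyTrivialFactorisations (π ⊖bar1) → ⊖-Indecomposable π
⊖bar1-indecomposable π v ne irr = v , (λ e → ne (cong _⊖bar1 e)) , λ { (π1 , π2 , v1 , v2 , n1 , n2 , e) →
  [ (λ e' → n1 (⊖bar1≡bar1⇒[] e')) , (λ e' → n2 (⊖bar1≡bar1⇒[] e')) ]′ (irr (π1 ⊖bar1) (π2 ⊖bar1) (⊖bar1-valid v1) (⊖bar1-valid v2) (trans (⊖bar1⋆⊖bar1 π1 π2) (cong _⊖bar1 e))) }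

map-pred-↭ : ∀ (r : List ℕ) L → r ↭ map suc (upTo L) → (map pred r ↭ upTo L) × map suc (map pred r) ≡ r
map-pred-↭ r L p = subst (map pred r ↭_) e1 (map⁺ pred p) , trans (sym (map-∘ r)) (map-id-local (All.tabulate f))
  where
  e1 : map pred (map suc (upTo L)) ≡ upTo L
  e1 = trans (sym (map-∘ (upTo L))) (map-id (upTo L))
  f : ∀ {y} → y ∈ r → suc (pred y) ≡ y
  f m with ∈-map⁻ suc (∈-resp-↭ p m)
  ... | z , _ , refl = refl

split-last : ∀ (l : List ℕ) n → length l ≡ suc n → Σ (List ℕ) λ r → Σ ℕ λ x → l ≡ r ++ [ x ] × length r ≡ n
split-last (x ∷ []) zero _ = [] , x , refl , refl
split-last (x ∷ []) (suc n) ()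
split-last (x ∷ y ∷ l) zero ()
split-last (x ∷ y ∷ l) (suc n) e with split-last (y ∷ l) n (suc-injective e)
... | r , z , e' , er = x ∷ r , z , cong (x ∷_) e' , cong suc er

abstract
  bar1⊕-shape : ∀ ξ → ValidMPerm ξ → mark ξ ≡ 0 → nth (vals ξ) 0 ≡ 0 → Σ (List ℕ) λ τ → ValidPerm τ × ξ ≡ bar1⊕ τ
  bar1⊕-shape ((.0 ∷ r) at .0) (p , q) refl refl with map-pred-↭ r (length r) (subst (r ↭_) (sym (map-upTo suc (length r))) (drop-mid [] [] p))
  ... | v , e = map pred r , subst (λ z → map pred r ↭ upTo z) (sym (length-map pred r)) v , cong₂ _at_ (cong (0 ∷_) (sym e)) refl

abstract
  ⊕bar1-shape : ∀ ξ → ValidMPerm ξ → suc (mark ξ) ≡ length (vals ξ) → nth (vals ξ) (mark ξ) ≡ mark ξ → Σ (List ℕ) λ τ → ValidPerm τ × ξ ≡ τ ⊕bar1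
  ⊕bar1-shape (l at c) (p , q) e1 e2 with split-last l c (sym e1)
  ... | r , x , refl , refl = r , vr , cong₂ _at_ (cong (λ z → r ++ [ z ]) (trans ex (sym (+-identityʳ _)))) refl
    where
    ex : x ≡ length r
    ex = trans (sym (nth-∷ʳ r x)) e2
    p' : r ++ [ length r ] ++ [] ↭ upTo (length r) ++ [ length r ] ++ []
    p' = subst₂ _↭_ (trans (cong (λ z → r ++ [ z ]) ex) (cong (r ++_) refl)) (trans (cong upTo (length-∷ʳ r x)) (sym (upTo-∷ʳ (length r)))) p
    vr : r ↭ upTo (length r)
    vr = subst₂ _↭_ (++-identityʳ r) (++-identityʳ _) (drop-mid r (upTo (length r)) p')

abstract
  bar1⊖-shape : ∀ ξ → ValidMPerm ξ → mark ξ ≡ 0 → suc (nth (vals ξ) 0) ≡ length (vals ξ) → Σ (List ℕ) λ π → ValidPerm π × ξ ≡ bar1⊖ π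
  bar1⊖-shape ((x ∷ r) at .0) (p , q) refl e2 = r , vr , cong₂ _at_ (cong (_∷ r) (trans (suc-injective e2) (sym (+-identityʳ _)))) refl
    where
    p' : [] ++ [ length r ] ++ r ↭ upTo (length r) ++ [ length r ] ++ []
    p' = subst₂ _↭_ (cong (_∷ r) (suc-injective e2)) (sym (upTo-∷ʳ (length r))) p
    vr : r ↭ upTo (length r)
    vr = subst (r ↭_) (++-identityʳ _) (drop-mid [] (upTo (length r)) p')

abstract
  ⊖bar1-shape : ∀ ξ → ValidMPerm ξ → suc (mark ξ) ≡ length (vals ξ) → nth (vals ξ) (mark ξ) ≡ 0 → Σ (List ℕ) λ π → ValidPerm π × ξ ≡ π ⊖bar1
  ⊖bar1-shape (l at c) (p , q) e1 e2 with split-last l c (sym e1)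
  ... | r , x , refl , refl with map-pred-↭ r (length r) pr
    where
    ex : x ≡ 0
    ex = trans (sym (nth-∷ʳ r x)) e2
    p' : r ++ [ 0 ] ++ [] ↭ [] ++ [ 0 ] ++ map suc (upTo (length r))
    p' = subst₂ _↭_ (cong (λ z → r ++ [ z ]) ex) (trans (cong upTo (length-∷ʳ r x)) (upTo-suc (length r))) p
    pr : r ↭ map suc (upTo (length r))
    pr = subst (_↭ map suc (upTo (length r))) (++-identityʳ r) (drop-mid r [] p')
  ... | v , e = map pred r , subst (λ z → map pred r ↭ upTo z) (sym (length-map pred r)) v ,
        cong₂ _at_ (cong₂ (λ u z → u ++ [ z ]) (sym e) ex) (sym (length-map pred r))
    where
    ex : x ≡ 0
    ex = trans (sym (nth-∷ʳ r x)) e2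

injective⇒≤ : ∀ ka kv (f : ℕ → ℕ) → (∀ i → i < ka → f i < kv) → (∀ i j → i < ka → j < ka → f i ≡ f j → i ≡ j) → ka ≤ kv
injective⇒≤ ka kv f b ij = FP.injective⇒≤ {f = F} Finj
  where
  F : Fin ka → Fin kv
  F i = fromℕ< (b (toℕ i) (FP.toℕ<n i))
  Finj : ∀ {x y} → F x ≡ F y → x ≡ y
  Finj {x} {y} e = FP.toℕ-injective (ij (toℕ x) (toℕ y) (FP.toℕ<n x) (FP.toℕ<n y)
    (trans (sym (FP.toℕ-fromℕ< (b (toℕ x) (FP.toℕ<n x)))) (trans (cong toℕ e) (FP.toℕ-fromℕ< (b (toℕ y) (FP.toℕ<n y))))))

-- Overlapping intervals

InRange : ℕ → ℕ → ℕ → Set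
InRange x y z = x ≤ z × z < y

range-injection⇒≤ : ∀ {p q v w} (f : ℕ → ℕ) → p ≤ q → (∀ i → InRange p q i → InRange v w (f i)) →
  (∀ i j → InRange p q i → InRange p q j → f i ≡ f j → i ≡ j) → q ∸ p ≤ w ∸ v
range-injection⇒≤ {p} {q} {v} {w} f p≤q into f-inj = injective⇒≤ (q ∸ p) (w ∸ v) (λ j → f (p + j) ∸ v) bounded injective
  where
  shifted : ∀ {j} → j < q ∸ p → InRange p q (p + j)
  shifted {j} j< = m≤m+n p j , subst (p + j <_) (m+[n∸m]≡n p≤q) (+-monoʳ-< p j<)
  bounded : ∀ j → j < q ∸ p → f (p + j) ∸ v < w ∸ v
  bounded j j< = let (v≤ , <w) = into (p + j) (shifted j<) in ∸-monoˡ-< <w v≤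
  injective : ∀ i j → i < q ∸ p → j < q ∸ p → f (p + i) ∸ v ≡ f (p + j) ∸ v → i ≡ j
  injective i j i< j< e = +-cancelˡ-≡ p i j (f-inj (p + i) (p + j) (shifted i<) (shifted j<)
    (∸-cancelʳ-≡ (proj₁ (into (p + i) (shifted i<))) (proj₁ (into (p + j) (shifted j<))) e))

index-of : List ℕ → ℕ → ℕ
index-of [] y = 0
index-of (x ∷ s) y with x ≟ y
... | yes _ = 0
... | no _ = suc (index-of s y)

index-of-∈ : ∀ s {y} → y ∈ s → index-of s y < length s × nth s (index-of s y) ≡ y
index-of-∈ (x ∷ s) {y} y∈ with x ≟ y | y∈
... | yes x≡y | _ = s≤s z≤n , x≡y
... | no x≢y | here y≡x = ⊥-elim (x≢y (sym y≡x))
... | no x≢y | there y∈s = let (i< , e) = index-of-∈ s y∈s in s≤s i< , e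

nth-index-of : ∀ {s} → IsPermutation s → ∀ {y} → y < length s → index-of s y < length s × nth s (index-of s y) ≡ y
nth-index-of {s} vs y< = let (i , i< , e) = nth-surjective vs y< in index-of-∈ s (subst (_∈ s) e (nth-∈ s i<))

-- Two ranges that nth s maps onto each other have equal lengths (compare
-- through nth s one way and through its inverse index-of s the other way).
abstract
  block-from-⇔ : ∀ {s} → IsPermutation s → ∀ p q v w → p < q → q ≤ length s → v ≤ w → w ≤ length s →
    (∀ i → i < length s → InRange p q i → InRange v w (nth s i)) → (∀ i → i < length s → InRange v w (nth s i) → InRange p q i) →
    Σ ℕ λ k → Block s p k v × p + k ≡ q × v + k ≡ w
  block-from-⇔ {s} vs p q v w p<q q≤n v≤w w≤n into from =
    q ∸ p , mkBlock (m<n⇒0<n∸m p<q) (≤-trans (≤-reflexive p+k≡q) q≤n) (≤-trans (≤-reflexive v+k≡w) w≤n) image preimage ,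
    p+k≡q , v+k≡w
    where
    p+k≡q : p + (q ∸ p) ≡ q
    p+k≡q = m+[n∸m]≡n (<⇒≤ p<q)
    position<n : ∀ {i} → InRange p q i → i < length s
    position<n (_ , i<q) = <-≤-trans i<q q≤n
    value<n : ∀ {y} → InRange v w y → y < length s
    value<n (_ , y<w) = <-≤-trans y<w w≤n
    back : ∀ y → InRange v w y → InRange p q (index-of s y)
    back y r = let (i< , e) = nth-index-of vs (value<n r) in from (index-of s y) i< (subst (InRange v w) (sym e) r)
    back-injective : ∀ y y′ → InRange v w y → InRange v w y′ → index-of s y ≡ index-of s y′ → y ≡ y′
    back-injective y y′ r r′ e =
      trans (sym (proj₂ (nth-index-of vs (value<n r)))) (trans (cong (nth s) e) (proj₂ (nth-index-of vs (value<n r′))))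
    k≡ : q ∸ p ≡ w ∸ v
    k≡ = ≤-antisym
      (range-injection⇒≤ (nth s) (<⇒≤ p<q) (λ i r → into i (position<n r) r) (λ i j r r′ → nth-injective vs (position<n r) (position<n r′)))
      (range-injection⇒≤ (index-of s) v≤w back back-injective)
    v+k≡w : v + (q ∸ p) ≡ w
    v+k≡w = trans (cong (v +_) k≡) (m+[n∸m]≡n v≤w)
    image : ∀ j → j < q ∸ p → v ≤ nth s (p + j) × nth s (p + j) < v + (q ∸ p)
    image j j< = let r = (m≤m+n p j , subst (p + j <_) p+k≡q (+-monoʳ-< p j<)) ; (v≤ , <w) = into (p + j) (position<n r) r
                 in v≤ , subst (nth s (p + j) <_) (sym v+k≡w) <w
    preimage : ∀ i → i < length s → v ≤ nth s i → nth s i < v + (q ∸ p) → p ≤ i × i < p + (q ∸ p)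
    preimage i i<n v≤ <v+k = let (p≤ , <q) = from i i<n (v≤ , subst (nth s i <_) v+k≡w <v+k) in p≤ , subst (i <_) (sym p+k≡q) <q

InRange-⊆-∪ : ∀ {x1 x2 y1 y2 z} → x2 ≤ y1 → InRange x1 y2 z → InRange x1 y1 z ⊎ InRange x2 y2 z
InRange-⊆-∪ {x1} {x2} {y1} {y2} {z} le (u , v) with z <? y1
... | yes lt = inj₁ (u , lt)
... | no nlt = inj₂ (≤-trans le (≮⇒≥ nlt) , v)

InRange-∪-⊆ : ∀ {x1 x2 y1 y2 z} → x1 ≤ x2 → y1 ≤ y2 → InRange x1 y1 z ⊎ InRange x2 y2 z → InRange x1 y2 z
InRange-∪-⊆ l1 l2 (inj₁ (u , v)) = u , <-≤-trans v l2
InRange-∪-⊆ l1 l2 (inj₂ (u , v)) = ≤-trans l1 u , v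

InRange-⊆-∩ : ∀ {x1 x2 y1 y2 z} → x1 ≤ x2 → y1 ≤ y2 → InRange x2 y1 z → InRange x1 y1 z × InRange x2 y2 z
InRange-⊆-∩ l1 l2 (u , v) = (≤-trans l1 u , v) , (u , <-≤-trans v l2)

InRange-∩-⊆ : ∀ {x1 x2 y1 y2 z} → InRange x1 y1 z → InRange x2 y2 z → InRange x2 y1 z
InRange-∩-⊆ (u , v) (u' , v') = u' , v

¬InRange⇒outside : ∀ {x y z} → ¬ InRange x y z → z < x ⊎ y ≤ z
¬InRange⇒outside {x} {y} {z} h with z <? x
... | yes lt = inj₁ lt
... | no nlt with z <? y
... | yes lt = ⊥-elim (h (≮⇒≥ nlt , lt))
... | no nlt' = inj₂ (≮⇒≥ nlt')

image-inRange : ∀ {s a k b} → Block s a k b → ∀ i → InRange a (a + k) i → InRange b (b + k) (nth s i)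
image-inRange W i (u , v) = image-inside′ W i u v

preimage-inRange : ∀ {s a k b} → Block s a k b → ∀ i → i < length s → InRange b (b + k) (nth s i) → InRange a (a + k) i
preimage-inRange W i r (u , v) = preimage-inside W i r u v

CommutingSquare : MPerm → MPerm → MPerm → MPerm → Set
CommutingSquare ξ α η β = Σ MPerm λ γ → IsMPerm γ × α ≡ η ⋆ γ × β ≡ ξ ⋆ γ × Commuting ξ η

-- The intervals [a1, a1 + k1) of α and [a2, a2 + k2) of β in σ = ξ ⋆ α = η ⋆ β
-- overlap without nesting. Their union and intersection are again intervals;
-- by irreducibility of ξ (Nested) the union is all of σ, which pins ξ, η and
-- the pieces of α, β outside the intersection down to ⊕- or ⊖-shapes.
module Overlapping (ξ α η β : MPerm) (vξ : IsMPerm ξ) (vα : IsMPerm α) (vη : IsMPerm η) (vβ : IsMPerm β)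
  (nξ : ¬ ξ ≡ bar1) (nη : ¬ η ≡ bar1) (irrξ : HasOnlyTrivialFactorisations ξ) (irrη : HasOnlyTrivialFactorisations η)
  (eq : η ⋆ β ≡ ξ ⋆ α) (vs : IsPermutation (vals (ξ ⋆ α)))
  (a1<a2 : mark ξ < mark η) (e1<e2 : mark ξ + length (vals α) < mark η + length (vals β)) where

  s = vals (ξ ⋆ α)
  n = length s
  a1 = mark ξ
  k1 = length (vals α)
  b1 = nth (vals ξ) a1
  a2 = mark η
  k2 = length (vals β)
  b2 = nth (vals η) a2
  W1 : Block s a1 k1 b1
  W1 = ⋆-block ξ α vξ vα
  W2 : Block s a2 k2 b2
  W2 = Block-resp (cong vals eq) refl refl refl (⋆-block η β vη vβ)
  M = mark (ξ ⋆ α)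
  eM : a2 + mark β ≡ M
  eM = cong mark eq
  a2≤M : a2 ≤ M
  a2≤M = subst (a2 ≤_) eM (m≤m+n a2 (mark β))
  M<e1 : M < a1 + k1
  M<e1 = +-monoʳ-< a1 (proj₂ vα)
  M<e2 : M < a2 + k2
  M<e2 = subst (_< a2 + k2) eM (+-monoʳ-< a2 (proj₂ vβ))
  a1≤M : a1 ≤ M
  a1≤M = m≤m+n a1 (mark α)
  a2<e1 : a2 < a1 + k1
  a2<e1 = ≤-<-trans a2≤M M<e1
  a1≤a2 = <⇒≤ a1<a2
  e1≤e2 = <⇒≤ e1<e2

  sM = nth s M
  V1M : InRange b1 (b1 + k1) sM
  V1M = image-inRange W1 M (a1≤M , M<e1)
  V2M : InRange b2 (b2 + k2) sM
  V2M = image-inRange W2 M (a2≤M , M<e2)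

  m2 = k2 ∸ 1
  ek2 : k2 ≡ suc m2
  ek2 = Inflation.ek η β vη vβ
  e2 = a2 + m2
  e2<e : e2 < a2 + k2
  e2<e = subst (λ z → e2 < a2 + z) (sym ek2) (+-monoʳ-< a2 (n<1+n m2))
  e2<n : e2 < n
  e2<n = <-≤-trans e2<e (positions-fit W2)
  a1<n : a1 < n
  a1<n = ≤-<-trans a1≤M (<-≤-trans M<e1 (positions-fit W1))
  k1pos = nonempty W1

  sa1V1 : InRange b1 (b1 + k1) (nth s a1)
  sa1V1 = image-inRange W1 a1 (≤-refl , m<m+n a1 k1pos)
  sa1V2 : ¬ InRange b2 (b2 + k2) (nth s a1)
  sa1V2 h = <⇒≱ a1<a2 (proj₁ (preimage-inRange W2 a1 a1<n h))
  se2V2 : InRange b2 (b2 + k2) (nth s e2)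
  se2V2 = image-inRange W2 e2 (m≤m+n a2 m2 , e2<e)
  ek2' : a2 + k2 ≡ suc e2
  ek2' = trans (cong (a2 +_) ek2) (+-suc a2 m2)
  e1≤e2' : a1 + k1 ≤ e2
  e1≤e2' = s≤s⁻¹ (subst (suc (a1 + k1) ≤_) ek2' e1<e2)
  se2V1 : ¬ InRange b1 (b1 + k1) (nth s e2)
  se2V1 h = <⇒≱ (proj₂ (preimage-inRange W1 e2 e2<n h)) e1≤e2'

  -- The value ranges of the two intervals overlap in the order of their
  -- position ranges (the ⊕ case) or in the reverse order (the ⊖ case).
  data Orientation : Set where
    plus : b1 ≤ b2 → b1 + k1 ≤ b2 + k2 → Orientation
    minus : b2 ≤ b1 → b2 + k2 ≤ b1 + k1 → Orientation

  orientation : Orientation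
  orientation with ¬InRange⇒outside sa1V2 | ¬InRange⇒outside se2V1
  ... | inj₁ x | inj₂ y = plus (<⇒≤ (≤-<-trans (proj₁ sa1V1) x)) (<⇒≤ (≤-<-trans y (proj₂ se2V2)))
  ... | inj₂ x | inj₁ y = minus (<⇒≤ (≤-<-trans (proj₁ se2V2) y)) (<⇒≤ (≤-<-trans x (proj₂ sa1V1)))
  ... | inj₁ x | inj₁ y = ⊥-elim (<-asym (≤-<-trans (proj₁ sa1V1) x) (≤-<-trans (proj₁ se2V2) y))
  ... | inj₂ x | inj₂ y = ⊥-elim (<-asym (≤-<-trans x (proj₂ sa1V1)) (≤-<-trans y (proj₂ se2V2)))

  b2≤e1v : b2 ≤ b1 + k1
  b2≤e1v = <⇒≤ (≤-<-trans (proj₁ V2M) (proj₂ V1M))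
  b1≤e2v : b1 ≤ b2 + k2
  b1≤e2v = <⇒≤ (≤-<-trans (proj₁ V1M) (proj₂ V2M))
  a2≤e1 : a2 ≤ a1 + k1
  a2≤e1 = <⇒≤ a2<e1
  a1<q : a1 < a2 + k2
  a1<q = <-≤-trans (m<m+n a1 k1pos) e1≤e2

  whole-from-union : ∀ kU bU w → Block s a1 kU bU → a1 + kU ≡ a2 + k2 → bU + kU ≡ w → bU ≡ 0 × w ≡ n × a1 ≡ 0 × a2 + k2 ≡ n
  whole-from-union kU bU w WU eU ew with Nested.dichotomy ξ α vξ vα irrξ vs a1 kU bU WU ≤-refl (subst (a1 + k1 ≤_) (sym eU) e1≤e2)
  ... | inj₁ (_ , kk) = ⊥-elim (<-irrefl (sym (trans (sym eU) (cong (a1 +_) kk))) e1<e2)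
  ... | inj₂ (a0 , kn) = b0 , trans (sym ew) (trans (cong (_+ kU) b0) kn) , a0 , trans (sym eU) (trans (cong₂ _+_ a0 kn) refl)
    where
    b0 : bU ≡ 0
    b0 = n≤0⇒n≡0 (+-cancelʳ-≤ kU bU 0 (subst (bU + kU ≤_) (sym kn) (values-fit WU)))

  ⊕-union-whole : b1 ≤ b2 → b1 + k1 ≤ b2 + k2 → b1 ≡ 0 × b2 + k2 ≡ n × a1 ≡ 0 × a2 + k2 ≡ n
  ⊕-union-whole pb pe with block-from-⇔ vs a1 (a2 + k2) b1 (b2 + k2) a1<q (positions-fit W2) b1≤e2v (values-fit W2) fw bw
    where
    fw : ∀ i → i < n → InRange a1 (a2 + k2) i → InRange b1 (b2 + k2) (nth s i)
    fw i r h = InRange-∪-⊆ pb pe (Sum.map (image-inRange W1 i) (image-inRange W2 i) (InRange-⊆-∪ a2≤e1 h))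
    bw : ∀ i → i < n → InRange b1 (b2 + k2) (nth s i) → InRange a1 (a2 + k2) i
    bw i r h = InRange-∪-⊆ a1≤a2 e1≤e2 (Sum.map (preimage-inRange W1 i r) (preimage-inRange W2 i r) (InRange-⊆-∪ b2≤e1v h))
  ... | kU , WU , eU , ew = whole-from-union kU b1 (b2 + k2) WU eU ew

  ⊖-union-whole : b2 ≤ b1 → b2 + k2 ≤ b1 + k1 → b2 ≡ 0 × b1 + k1 ≡ n × a1 ≡ 0 × a2 + k2 ≡ n
  ⊖-union-whole mb me with block-from-⇔ vs a1 (a2 + k2) b2 (b1 + k1) a1<q (positions-fit W2) b2≤e1v (values-fit W1) fw bw
    where
    fw : ∀ i → i < n → InRange a1 (a2 + k2) i → InRange b2 (b1 + k1) (nth s i)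
    fw i r h = InRange-∪-⊆ mb me (Sum.swap (Sum.map (image-inRange W1 i) (image-inRange W2 i) (InRange-⊆-∪ a2≤e1 h)))
    bw : ∀ i → i < n → InRange b2 (b1 + k1) (nth s i) → InRange a1 (a2 + k2) i
    bw i r h = InRange-∪-⊆ a1≤a2 e1≤e2 (Sum.swap (Sum.map (preimage-inRange W2 i r) (preimage-inRange W1 i r) (InRange-⊆-∪ b1≤e2v h)))
  ... | kU , WU , eU , ew = whole-from-union kU b2 (b1 + k1) WU eU ew

  ⊕-intersection : b1 ≤ b2 → b1 + k1 ≤ b2 + k2 → Σ ℕ λ kK → Block s a2 kK b2 × a2 + kK ≡ a1 + k1 × b2 + kK ≡ b1 + k1
  ⊕-intersection pb pe = block-from-⇔ vs a2 (a1 + k1) b2 (b1 + k1) a2<e1 (positions-fit W1) b2≤e1v (values-fit W1)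
    (λ i r h → let both = InRange-⊆-∩ a1≤a2 e1≤e2 h in InRange-∩-⊆ (image-inRange W1 i (proj₁ both)) (image-inRange W2 i (proj₂ both)))
    (λ i r h → let both = InRange-⊆-∩ pb pe h in InRange-∩-⊆ (preimage-inRange W1 i r (proj₁ both)) (preimage-inRange W2 i r (proj₂ both)))

  ⊖-intersection : b2 ≤ b1 → b2 + k2 ≤ b1 + k1 → Σ ℕ λ kK → Block s a2 kK b1 × a2 + kK ≡ a1 + k1 × b1 + kK ≡ b2 + k2
  ⊖-intersection mb me = block-from-⇔ vs a2 (a1 + k1) b1 (b2 + k2) a2<e1 (positions-fit W1) b1≤e2v (values-fit W2)
    (λ i r h → let both = InRange-⊆-∩ a1≤a2 e1≤e2 h in InRange-∩-⊆ (image-inRange W2 i (proj₂ both)) (image-inRange W1 i (proj₁ both)))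
    (λ i r h → let both = InRange-⊆-∩ mb me h in InRange-∩-⊆ (preimage-inRange W1 i r (proj₂ both)) (preimage-inRange W2 i r (proj₁ both)))

  module Common (kK bK : ℕ) (WK : Block s a2 kK bK) (eK : a2 + kK ≡ a1 + k1) (db db' : ℕ) (edb : b1 + db ≡ bK) (edb' : b2 + db' ≡ bK) where
    mK = kK ∸ 1
    ekK : kK ≡ suc mK
    ekK = ≡suc-pred (nonempty WK)
    da = proj₁ (split≤ a1≤a2)
    eda : a2 ≡ a1 + da
    eda = proj₂ (split≤ a1≤a2)

    WKα : Block (vals (ξ ⋆ α)) (mark ξ + da) (suc mK) (nth (vals ξ) (mark ξ) + db)
    WKα = Block-resp refl eda ekK (sym edb) WK
    insideα : mark ξ + da + suc mK ≤ mark ξ + length (vals α)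
    insideα = ≤-reflexive (trans (cong₂ _+_ (sym eda) (sym ekK)) eK)
    resα = Restriction.restricted-block ξ α vξ vα vs mK da db WKα insideα

    da≤c1 : da ≤ mark α
    da≤c1 = +-cancelˡ-≤ a1 da (mark α) (subst (_≤ M) eda a2≤M)
    c1< : mark α < da + suc mK
    c1< = +-cancelˡ-< a1 (mark α) (da + suc mK) (subst (M <_) (trans (sym eK) (trans (cong₂ _+_ eda ekK) (+-assoc a1 da (suc mK)))) M<e1)

    open FactorisationAt (block⇒factorisation (vals α) (mark α) (proj₁ vα) da (suc mK) db resα da≤c1 c1<) public
      renaming (outer to X; inner to γ; outer-isMPerm to vX; inner-isMPerm to vγ; ⋆-≡ to eXγ; outer-mark to eXm; inner-length to eγ; outer-value to eXb)

    esβ : vals (η ⋆ β) ≡ s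
    esβ = cong vals eq
    vsβ : IsPermutation (vals (η ⋆ β))
    vsβ = subst IsPermutation (sym esβ) vs
    WKβ : Block (vals (η ⋆ β)) (mark η + 0) (suc mK) (nth (vals η) (mark η) + db')
    WKβ = Block-resp (sym esβ) (sym (+-identityʳ a2)) ekK (sym edb') WK
    insideβ : mark η + 0 + suc mK ≤ mark η + length (vals β)
    insideβ = subst (_≤ a2 + k2) (trans (cong (a2 +_) ekK) (cong (_+ suc mK) (sym (+-identityʳ a2)))) (subst (_≤ a2 + k2) (sym eK) e1≤e2)
    resβ = Restriction.restricted-block η β vη vβ vsβ mK 0 db' WKβ insideβ
    c2< : mark β < 0 + suc mK
    c2< = +-cancelˡ-< a2 (mark β) (suc mK) (subst₂ _<_ (sym eM) (trans (sym eK) (cong (a2 +_) ekK)) M<e1)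

    open FactorisationAt (block⇒factorisation (vals β) (mark β) (proj₁ vβ) 0 (suc mK) db' resβ z≤n c2<) public
      renaming (outer to X′; inner to γ′; outer-isMPerm to vX′; inner-isMPerm to vγ′; ⋆-≡ to eXγ′; outer-mark to eXm′; inner-length to eγ′; outer-value to eXb′)

    eL : (ξ ⋆ X) ⋆ γ ≡ ξ ⋆ α
    eL = trans (Associativity.⋆-assoc ξ X γ vξ vX vγ) (cong (ξ ⋆_) eXγ)
    eR : (η ⋆ X′) ⋆ γ′ ≡ ξ ⋆ α
    eR = trans (Associativity.⋆-assoc η X′ γ′ vη vX′ vγ′) (trans (cong (η ⋆_) eXγ′) eq)
    canc = ⋆-cancel (ξ ⋆ X) γ (η ⋆ X′) γ′ (Inflation.isMPerm ξ X vξ vX) vγ (Inflation.isMPerm η X′ vη vX′) vγ′ (trans eL (sym eR))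
      (trans (cong (a1 +_) eXm) (trans (sym eda) (sym (trans (cong (a2 +_) eXm′) (+-identityʳ a2))))) (trans eγ (sym eγ′))
    eξX : ξ ⋆ X ≡ η ⋆ X′
    eξX = proj₁ canc
    eγγ : γ ≡ γ′
    eγγ = proj₂ canc

    lenη : a2 + k2 ≡ n → length (vals η) ≡ suc a2
    lenη e2n = +-cancelʳ-≡ k2 _ _ (trans (sym (Inflation.suc-length η β vη vβ)) (trans (cong (λ z → suc (length z)) esβ) (cong suc (sym e2n))))

    lenX : a1 ≡ 0 → length (vals X) ≡ suc (mark X)
    lenX a0 = trans (+-cancelʳ-≡ kK (length (vals X)) (suc da) main) (cong suc (sym eXm))
      where
      a2≡da : a2 ≡ da
      a2≡da = trans eda (cong (_+ da) a0)
      k1eq : k1 ≡ da + kK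
      k1eq = trans (sym (cong (_+ k1) a0)) (trans (sym eK) (cong (_+ kK) a2≡da))
      lγ : length (vals γ) ≡ kK
      lγ = trans eγ (sym ekK)
      main : length (vals X) + kK ≡ suc da + kK
      main = trans (cong (length (vals X) +_) (sym lγ)) (trans (sym (Inflation.suc-length X γ vX vγ)) (trans (cong (λ z → suc (length (vals z))) eXγ) (cong suc k1eq)))

  ⊕-square : b1 ≤ b2 → b1 + k1 ≤ b2 + k2 → CommutingSquare ξ α η β
  ⊕-square pb pe with ⊕-union-whole pb pe | ⊕-intersection pb pe
  ... | b1≡0 , _ , a1≡0 , e2≡n | kK , WK , eK , _ = C.γ , C.vγ , eα , eβ , inj₁ (τ1 , τ2 , ξ-indecomposable , η-indecomposable , inj₁ (eξ , eη))
    where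
    module C = Common kK b2 WK eK b2 0 (cong (_+ b2) b1≡0) (+-identityʳ b2)
    b2≡a2 : b2 ≡ a2
    b2≡a2 = +-cancelʳ-≡ k2 b2 a2 (trans (proj₁ (proj₂ (⊕-union-whole pb pe))) (sym e2≡n))
    da≡a2 : C.da ≡ a2
    da≡a2 = sym (trans C.eda (cong (_+ C.da) a1≡0))
    Sξ = bar1⊕-shape ξ (IsMPerm⇒Valid vξ) a1≡0 (trans (cong (nth (vals ξ)) (sym a1≡0)) b1≡0)
    τ1 = proj₁ Sξ
    v1 = proj₁ (proj₂ Sξ)
    eξ = proj₂ (proj₂ Sξ)
    Sη = ⊕bar1-shape η (IsMPerm⇒Valid vη) (sym (C.lenη e2≡n)) b2≡a2
    τ2 = proj₁ Sη
    v2 = proj₁ (proj₂ Sη)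
    eη = proj₂ (proj₂ Sη)
    SX = ⊕bar1-shape C.X (IsMPerm⇒Valid C.vX) (sym (C.lenX a1≡0)) (trans C.eXb (trans b2≡a2 (sym (trans C.eXm da≡a2))))
    τx = proj₁ SX
    eX = proj₂ (proj₂ SX)
    SX' = bar1⊕-shape C.X′ (IsMPerm⇒Valid C.vX′) C.eXm′ (trans (cong (nth (vals C.X′)) (sym C.eXm′)) C.eXb′)
    τx' = proj₁ SX'
    eX' = proj₂ (proj₂ SX')
    ci = ⊕-cross-injective τx τ1 τ2 τx' (trans (sym (bar1⊕⋆⊕bar1 τx τ1)) (trans (cong₂ _⋆_ (sym eξ) (sym eX)) (trans C.eξX (trans (cong₂ _⋆_ eη eX') (⊕bar1⋆bar1⊕ τ2 τx' v2)))))
    Xη : C.X ≡ η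
    Xη = trans eX (trans (cong _⊕bar1 (proj₁ ci)) (sym eη))
    X'ξ : C.X′ ≡ ξ
    X'ξ = trans eX' (trans (cong bar1⊕_ (sym (proj₂ ci))) (sym eξ))
    eα : α ≡ η ⋆ C.γ
    eα = trans (sym C.eXγ) (cong (_⋆ C.γ) Xη)
    eβ : β ≡ ξ ⋆ C.γ
    eβ = trans (sym C.eXγ′) (cong₂ _⋆_ X'ξ (sym C.eγγ))
    ξ-indecomposable : ⊕-Indecomposable τ1
    ξ-indecomposable = bar1⊕-indecomposable τ1 v1 (λ e → nξ (trans eξ e)) (subst HasOnlyTrivialFactorisations eξ irrξ)
    η-indecomposable : ⊕-Indecomposable τ2
    η-indecomposable = ⊕bar1-indecomposable τ2 v2 (λ e → nη (trans eη e)) (subst HasOnlyTrivialFactorisations eη irrη)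

  ⊖-square : b2 ≤ b1 → b2 + k2 ≤ b1 + k1 → CommutingSquare ξ α η β
  ⊖-square mb me with ⊖-union-whole mb me | ⊖-intersection mb me
  ... | b2≡0 , e1v≡n , a1≡0 , e2≡n | kK , WK , eK , ebK = C.γ , C.vγ , eα , eβ , inj₂ (π1 , π2 , ξ-indecomposable , η-indecomposable , inj₁ (eξ , eη))
    where
    module C = Common kK b1 WK eK 0 b1 (+-identityʳ b1) (cong (_+ b1) b2≡0)
    lenξ : length (vals ξ) ≡ suc b1
    lenξ = +-cancelʳ-≡ k1 _ _ (trans (sym (Inflation.suc-length ξ α vξ vα)) (cong suc (sym e1v≡n)))
    Sξ = bar1⊖-shape ξ (IsMPerm⇒Valid vξ) a1≡0 (trans (cong (λ z → suc (nth (vals ξ) z)) (sym a1≡0)) (sym lenξ))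
    π1 = proj₁ Sξ
    v1 = proj₁ (proj₂ Sξ)
    eξ = proj₂ (proj₂ Sξ)
    Sη = ⊖bar1-shape η (IsMPerm⇒Valid vη) (sym (C.lenη e2≡n)) b2≡0
    π2 = proj₁ Sη
    v2 = proj₁ (proj₂ Sη)
    eη = proj₂ (proj₂ Sη)
    SX = ⊖bar1-shape C.X (IsMPerm⇒Valid C.vX) (sym (C.lenX a1≡0)) C.eXb
    πx = proj₁ SX
    eX = proj₂ (proj₂ SX)
    lenX' : length (vals C.X′) ≡ suc b1
    lenX' = +-cancelʳ-≡ kK _ _ (trans (cong (length (vals C.X′) +_) (sym (trans C.eγ′ (sym C.ekK)))) 
      (trans (sym (Inflation.suc-length C.X′ C.γ′ C.vX′ C.vγ′)) (trans (cong (λ z → suc (length (vals z))) C.eXγ′) (cong suc (trans (sym (cong (_+ k2) b2≡0)) (sym ebK))))))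
    SX' = bar1⊖-shape C.X′ (IsMPerm⇒Valid C.vX′) C.eXm′ (trans (cong (λ z → suc (nth (vals C.X′) z)) (sym C.eXm′)) (trans (cong suc C.eXb′) (sym lenX')))
    πx' = proj₁ SX'
    eX' = proj₂ (proj₂ SX')
    ci = ⊖-cross-injective πx π1 π2 πx' (trans (sym (bar1⊖⋆⊖bar1 πx π1 v1)) (trans (cong₂ _⋆_ (sym eξ) (sym eX)) (trans C.eξX (trans (cong₂ _⋆_ eη eX') (⊖bar1⋆bar1⊖ π2 πx')))))
    Xη : C.X ≡ η
    Xη = trans eX (trans (cong _⊖bar1 (proj₁ ci)) (sym eη))
    X'ξ : C.X′ ≡ ξ
    X'ξ = trans eX' (trans (cong bar1⊖_ (sym (proj₂ ci))) (sym eξ))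
    eα : α ≡ η ⋆ C.γ
    eα = trans (sym C.eXγ) (cong (_⋆ C.γ) Xη)
    eβ : β ≡ ξ ⋆ C.γ
    eβ = trans (sym C.eXγ′) (cong₂ _⋆_ X'ξ (sym C.eγγ))
    ξ-indecomposable : ⊖-Indecomposable π1
    ξ-indecomposable = bar1⊖-indecomposable π1 v1 (λ e → nξ (trans eξ e)) (subst HasOnlyTrivialFactorisations eξ irrξ)
    η-indecomposable : ⊖-Indecomposable π2
    η-indecomposable = ⊖bar1-indecomposable π2 v2 (λ e → nη (trans eη e)) (subst HasOnlyTrivialFactorisations eη irrη)

  commuting-square : CommutingSquare ξ α η β
  commuting-square with orientation
  ... | plus pb pe = ⊕-square pb pe
  ... | minus mb me = ⊖-square mb me

-- Unique factorisation of the first letter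

Commuting-sym : ∀ {x y} → Commuting x y → Commuting y x
Commuting-sym (inj₁ (a , b , i , j , inj₁ (e1 , e2))) = inj₁ (a , b , i , j , inj₂ (e2 , e1))
Commuting-sym (inj₁ (a , b , i , j , inj₂ (e1 , e2))) = inj₁ (a , b , i , j , inj₁ (e2 , e1))
Commuting-sym (inj₂ (a , b , i , j , inj₁ (e1 , e2))) = inj₂ (a , b , i , j , inj₂ (e2 , e1))
Commuting-sym (inj₂ (a , b , i , j , inj₂ (e1 , e2))) = inj₂ (a , b , i , j , inj₁ (e2 , e1))

whole-block⇒bar1 : ∀ ξ α → IsMPerm ξ → IsMPerm α → length (vals α) ≡ length (vals (ξ ⋆ α)) → ξ ≡ bar1
whole-block⇒bar1 ξ α vξ vα e = length≡1⇒bar1 vξ (+-cancelʳ-≡ (length (vals α)) _ _ (trans (sym (Inflation.suc-length ξ α vξ vα)) (cong suc (sym e))))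

Diamond : MPerm → MPerm → MPerm → MPerm → Set
Diamond ξ α η β = (ξ ≡ η × α ≡ β) ⊎ CommutingSquare ξ α η β

nested-intervals-coincide : ∀ ξ α η β → IsMPerm ξ → IsMPerm α → IsMPerm η → IsMPerm β → ¬ ξ ≡ bar1 →
  HasOnlyTrivialFactorisations η → η ⋆ β ≡ ξ ⋆ α →
  mark ξ ≤ mark η → mark η + length (vals β) ≤ mark ξ + length (vals α) → mark ξ ≡ mark η × length (vals α) ≡ length (vals β)
nested-intervals-coincide ξ α η β vξ vα vη vβ ξ≢1 iη eq a₁≤a₂ e₂≤e₁
  with Nested.dichotomy η β vη vβ iη (proj₁ (Inflation.isMPerm η β vη vβ)) (mark ξ) (length (vals α)) (nth (vals ξ) (mark ξ))
         (Block-resp (sym (cong vals eq)) refl refl refl (⋆-block ξ α vξ vα)) a₁≤a₂ e₂≤e₁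
... | inj₁ coincide = coincide
... | inj₂ (_ , whole) = ⊥-elim (ξ≢1 (whole-block⇒bar1 ξ α vξ vα (trans whole (cong length (cong vals eq)))))

⋆-diamond : ∀ ξ α η β → IsMPerm ξ → IsMPerm α → IsMPerm η → IsMPerm β → ¬ ξ ≡ bar1 → ¬ η ≡ bar1 →
  HasOnlyTrivialFactorisations ξ → HasOnlyTrivialFactorisations η → η ⋆ β ≡ ξ ⋆ α → Diamond ξ α η β
⋆-diamond ξ α η β vξ vα vη vβ ξ≢1 η≢1 iξ iη eq = by-position (<-cmp a₁ a₂) (<-cmp e₁ e₂)
  where
  a₁ = mark ξ
  a₂ = mark η
  e₁ = mark ξ + length (vals α)
  e₂ = mark η + length (vals β)
  α⊇β : a₁ ≤ a₂ → e₂ ≤ e₁ → a₁ ≡ a₂ × length (vals α) ≡ length (vals β)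
  α⊇β = nested-intervals-coincide ξ α η β vξ vα vη vβ ξ≢1 iη eq
  β⊇α : a₂ ≤ a₁ → e₁ ≤ e₂ → a₂ ≡ a₁ × length (vals β) ≡ length (vals α)
  β⊇α = nested-intervals-coincide η β ξ α vη vβ vξ vα η≢1 iξ (sym eq)
  ends : ∀ {a a′ k k′} → a ≡ a′ × k ≡ k′ → a + k ≡ a′ + k′
  ends (a≡ , k≡) = cong₂ _+_ a≡ k≡
  by-position : Tri (a₁ < a₂) (a₁ ≡ a₂) (a₁ > a₂) → Tri (e₁ < e₂) (e₁ ≡ e₂) (e₁ > e₂) → Diamond ξ α η β
  by-position (tri< a₁<a₂ _ _) (tri< e₁<e₂ _ _) =
    inj₂ (Overlapping.commuting-square ξ α η β vξ vα vη vβ ξ≢1 η≢1 iξ iη eq (proj₁ (Inflation.isMPerm ξ α vξ vα)) a₁<a₂ e₁<e₂)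
  by-position (tri> _ _ a₂<a₁) (tri> _ _ e₂<e₁) =
    let (γ , vγ , β≡ξγ , α≡ηγ , c) = Overlapping.commuting-square η β ξ α vη vβ vξ vα η≢1 ξ≢1 iη iξ (sym eq)
                                       (proj₁ (Inflation.isMPerm η β vη vβ)) a₂<a₁ e₂<e₁
    in inj₂ (γ , vγ , α≡ηγ , β≡ξγ , Commuting-sym c)
  by-position (tri≈ _ a₁≡a₂ _) (tri≈ _ e₁≡e₂ _) =
    let (η≡ξ , β≡α) = ⋆-cancel η β ξ α vη vβ vξ vα eq (sym a₁≡a₂) (sym (+-cancelˡ-≡ a₁ _ _ (trans e₁≡e₂ (cong (_+ length (vals β)) (sym a₁≡a₂)))))
    in inj₁ (sym η≡ξ , sym β≡α)
  by-position (tri< a₁<a₂ _ _) (tri≈ _ e₁≡e₂ _) = ⊥-elim (<⇒≢ a₁<a₂ (proj₁ (α⊇β (<⇒≤ a₁<a₂) (≤-reflexive (sym e₁≡e₂)))))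
  by-position (tri< a₁<a₂ _ _) (tri> _ _ e₂<e₁) = ⊥-elim (<⇒≢ a₁<a₂ (proj₁ (α⊇β (<⇒≤ a₁<a₂) (<⇒≤ e₂<e₁))))
  by-position (tri≈ _ a₁≡a₂ _) (tri> _ _ e₂<e₁) = ⊥-elim (<⇒≢ e₂<e₁ (sym (ends (α⊇β (≤-reflexive a₁≡a₂) (<⇒≤ e₂<e₁)))))
  by-position (tri≈ _ a₁≡a₂ _) (tri< e₁<e₂ _ _) = ⊥-elim (<⇒≢ e₁<e₂ (sym (ends (β⊇α (≤-reflexive (sym a₁≡a₂)) (<⇒≤ e₁<e₂)))))
  by-position (tri> _ _ a₂<a₁) (tri≈ _ e₁≡e₂ _) = ⊥-elim (<⇒≢ a₂<a₁ (proj₁ (β⊇α (<⇒≤ a₂<a₁) (≤-reflexive e₁≡e₂))))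
  by-position (tri> _ _ a₂<a₁) (tri< e₁<e₂ _ _) = ⊥-elim (<⇒≢ a₂<a₁ (proj₁ (β⊇α (<⇒≤ a₂<a₁) (<⇒≤ e₁<e₂))))

-- The star map

⋆-identityˡ : ∀ σ → bar1 ⋆ σ ≡ σ
⋆-identityˡ (p at c) = cong₂ _at_ (trans (++-identityʳ _) (map-id p)) refl

inflVals-bar1 : ∀ t a b → a < length t → b ≡ nth t a → inflVals t a b 0 [ 0 ] ≡ t
inflVals-bar1 (x ∷ t) zero b _ refl = cong₂ _∷_ (+-identityʳ x) (map-id-local (All.tabulate (λ {y} _ → shiftV-identity x y)))
inflVals-bar1 (x ∷ t) (suc a) b (s≤s q) e = cong₂ _∷_ (shiftV-identity b x) (inflVals-bar1 t a b q e)

⋆-identityʳ : ∀ σ → IsMPerm σ → σ ⋆ bar1 ≡ σ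
⋆-identityʳ (t at a) (_ , q) = cong₂ _at_ (inflVals-bar1 t a (nth t a) q refl) (+-identityʳ a)

bar1-isMPerm : IsMPerm bar1
bar1-isMPerm = isPermutation bd ij , s≤s z≤n
  where
  bd : ∀ {i} → i < 1 → nth [ 0 ] i < 1
  bd (s≤s z≤n) = s≤s z≤n
  ij : ∀ {i j} → i < 1 → j < 1 → nth [ 0 ] i ≡ nth [ 0 ] j → i ≡ j
  ij (s≤s z≤n) (s≤s z≤n) _ = refl

star-isMPerm : ∀ w → IsWord w → IsMPerm (star w)
star-isMPerm [] _ = bar1-isMPerm
star-isMPerm (ξ ∷ w) (i ∷ iw) = Inflation.isMPerm ξ (star w) (Valid⇒IsMPerm (proj₁ i)) (star-isMPerm w iw)

star-++ : ∀ w w' → IsWord w → IsWord w' → star (w ++ w') ≡ star w ⋆ star w'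
star-++ [] w' _ _ = sym (⋆-identityˡ (star w'))
star-++ (ξ ∷ w) w' (i ∷ iw) iw' = trans (cong (ξ ⋆_) (star-++ w w' iw iw')) (sym (Associativity.⋆-assoc ξ (star w) (star w') (Valid⇒IsMPerm (proj₁ i)) (star-isMPerm w iw) (star-isMPerm w' iw')))

SwapStep-sym : ∀ {w w′} → SwapStep w w′ → SwapStep w′ w
SwapStep-sym (pre , suf , x , y , c , e₁ , e₂) = pre , suf , y , x , Commuting-sym c , e₂ , e₁

Irreducible⇒IsMPerm : ∀ {ξ} → Irreducible ξ → IsMPerm ξ
Irreducible⇒IsMPerm (v , _) = Valid⇒IsMPerm v

SwapStep-preserves : ∀ w w′ → SwapStep w w′ → IsWord w → star w ≡ star w′ × IsWord w′
SwapStep-preserves .(pre ++ x ∷ y ∷ suf) .(pre ++ y ∷ x ∷ suf) (pre , suf , x , y , c , refl , refl) iw =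
  trans (star-++ pre (x ∷ y ∷ suf) ip (ix ∷ iy ∷ isuf)) (trans (cong (star pre ⋆_) middle-swap) (sym (star-++ pre (y ∷ x ∷ suf) ip (iy ∷ ix ∷ isuf)))) ,
  AllP.++⁺ ip (iy ∷ ix ∷ isuf)
  where
  ip = AllP.++⁻ˡ pre iw
  ix = All.head (AllP.++⁻ʳ pre iw)
  iy = All.head (All.tail (AllP.++⁻ʳ pre iw))
  isuf = All.tail (All.tail (AllP.++⁻ʳ pre iw))
  vx = Irreducible⇒IsMPerm ix
  vy = Irreducible⇒IsMPerm iy
  vz = star-isMPerm suf isuf
  middle-swap : x ⋆ (y ⋆ star suf) ≡ y ⋆ (x ⋆ star suf)
  middle-swap = begin
    x ⋆ (y ⋆ star suf)  ≡⟨ Associativity.⋆-assoc x y (star suf) vx vy vz ⟨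
    (x ⋆ y) ⋆ star suf  ≡⟨ cong (_⋆ star suf) (Commuting⇒⋆-comm x y c) ⟩
    (y ⋆ x) ⋆ star suf  ≡⟨ Associativity.⋆-assoc y x (star suf) vy vx vz ⟩
    y ⋆ (x ⋆ star suf)  ∎
    where open ≡-Reasoning

∼⇒star-≡ : ∀ w w′ → IsWord w → w ∼ w′ → star w ≡ star w′
∼⇒star-≡ w .w iw ε = refl
∼⇒star-≡ w w′ iw (fwd s ◅ r) = let (e , iw₂) = SwapStep-preserves _ _ s iw in trans e (∼⇒star-≡ _ w′ iw₂ r)
∼⇒star-≡ w w′ iw (bwd s ◅ r) = let (e , iw₂) = SwapStep-preserves _ _ (SwapStep-sym s) iw in trans e (∼⇒star-≡ _ w′ iw₂ r)

all<? : ∀ n {P : ℕ → Set} → (∀ i → Dec (P i)) → Dec (∀ i → i < n → P i)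
all<? zero d = yes (λ i ())
all<? (suc n) {P} d with all<? n d | d n
... | yes f | yes p = yes g
  where
  g : ∀ i → i < suc n → P i
  g i q with i <? n
  ... | yes q' = f i q'
  ... | no nq = subst P (sym (≤-antisym (s≤s⁻¹ q) (≮⇒≥ nq))) p
... | no nf | _ = no (λ g → nf (λ i q → g i (m≤n⇒m≤1+n q)))
... | _ | no np = no (λ g → np (g n ≤-refl))

any<? : ∀ n {P : ℕ → Set} → (∀ i → Dec (P i)) → Dec (Σ ℕ λ i → i < n × P i)
any<? zero d = no (λ { (i , () , _) })
any<? (suc n) {P} d with d n | any<? n d
... | yes p | _ = yes (n , ≤-refl , p)
... | no _ | yes (i , q , p) = yes (i , m≤n⇒m≤1+n q , p)
... | no np | no nr = no h
  where
  h : ¬ (Σ ℕ λ i → i < suc n × P i)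
  h (i , q , p) with i <? n
  ... | yes q' = nr (i , q' , p)
  ... | no nq = np (subst P (≤-antisym (s≤s⁻¹ q) (≮⇒≥ nq)) p)

block? : ∀ s a k b → Dec (Block s a k b)
block? s a k b = map′ (λ (p , q , r , f , g) → mkBlock p q r f g) (λ W → nonempty W , positions-fit W , values-fit W , image-inside W , preimage-inside W)
  ((0 <? k) ×-dec (a + k ≤? length s) ×-dec (b + k ≤? length s) ×-dec
   all<? k (λ j → (b ≤? nth s (a + j)) ×-dec (nth s (a + j) <? b + k)) ×-dec
   all<? (length s) (λ i → (b ≤? nth s i) →-dec ((nth s i <? b + k) →-dec ((a ≤? i) ×-dec (i <? a + k)))))

ProperBlockAround : List ℕ → ℕ → ℕ → ℕ → ℕ → Set
ProperBlockAround s M a k b = Block s a k b × 2 ≤ k × k < length s × a ≤ M × M < a + k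

-- The bounds a, k, b < length s make the search space finite.
HasProperBlockAround : List ℕ → ℕ → Set
HasProperBlockAround s M = Σ ℕ λ a → a < length s × Σ ℕ λ k → k < length s × Σ ℕ λ b → b < length s × ProperBlockAround s M a k b

hasProperBlockAround? : ∀ s M → Dec (HasProperBlockAround s M)
hasProperBlockAround? s M = any<? n (λ a → any<? n (λ k → any<? n (λ b →
   block? s a k b ×-dec (2 ≤? k) ×-dec (k <? n) ×-dec (a ≤? M) ×-dec (M <? a + k))))
  where n = length s

proper-factorisation⇒proper-block : ∀ σ τ₁ τ₂ → IsMPerm τ₁ → IsMPerm τ₂ → ¬ τ₁ ≡ bar1 → ¬ τ₂ ≡ bar1 → τ₁ ⋆ τ₂ ≡ σ →
  HasProperBlockAround (vals σ) (mark σ)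
proper-factorisation⇒proper-block σ τ₁ τ₂ v₁ v₂ τ₁≢1 τ₂≢1 refl =
  mark τ₁ , a<n , length (vals τ₂) , k<n , nth (vals τ₁) (mark τ₁) , b<n , W , ≢bar1⇒2≤length v₂ τ₂≢1 , k<n , a≤M , M<a+k
  where
  W : Block (vals σ) (mark τ₁) (length (vals τ₂)) (nth (vals τ₁) (mark τ₁))
  W = ⋆-block τ₁ τ₂ v₁ v₂
  k<n : length (vals τ₂) < length (vals σ)
  k<n = s≤s⁻¹ (subst (suc (suc (length (vals τ₂))) ≤_) (sym (Inflation.suc-length τ₁ τ₂ v₁ v₂))
    (+-monoˡ-≤ (length (vals τ₂)) (≢bar1⇒2≤length v₁ τ₁≢1)))
  a<n : mark τ₁ < length (vals σ)
  a<n = <-≤-trans (m<m+n (mark τ₁) (nonempty W)) (positions-fit W)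
  b<n : nth (vals τ₁) (mark τ₁) < length (vals σ)
  b<n = <-≤-trans (m<m+n _ (nonempty W)) (values-fit W)
  a≤M : mark τ₁ ≤ mark σ
  a≤M = m≤m+n (mark τ₁) (mark τ₂)
  M<a+k : mark σ < mark τ₁ + length (vals τ₂)
  M<a+k = +-monoʳ-< (mark τ₁) (proj₂ v₂)

≢1⇒≢bar1 : ∀ {σ} → length (vals σ) ≢ 1 → σ ≢ bar1
≢1⇒≢bar1 l≢1 refl = l≢1 refl

no-proper-block⇒irreducible : ∀ σ → IsMPerm σ → length (vals σ) ≢ 1 → ¬ HasProperBlockAround (vals σ) (mark σ) → Irreducible σ
no-proper-block⇒irreducible σ v l≢1 no-block = IsMPerm⇒Valid v , ≢1⇒≢bar1 l≢1 , only-trivial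
  where
  only-trivial : HasOnlyTrivialFactorisations σ
  only-trivial τ₁ τ₂ v₁ v₂ τ₁⋆τ₂≡σ with length (vals τ₁) ≟ 1 | length (vals τ₂) ≟ 1
  ... | yes l₁≡1 | _ = inj₁ (length≡1⇒bar1 (Valid⇒IsMPerm v₁) l₁≡1)
  ... | no _ | yes l₂≡1 = inj₂ (length≡1⇒bar1 (Valid⇒IsMPerm v₂) l₂≡1)
  ... | no l₁≢1 | no l₂≢1 = contradiction
    (proper-factorisation⇒proper-block σ τ₁ τ₂ (Valid⇒IsMPerm v₁) (Valid⇒IsMPerm v₂) (≢1⇒≢bar1 l₁≢1) (≢1⇒≢bar1 l₂≢1) τ₁⋆τ₂≡σ)
    no-block

proper-block⇒smaller-factors : ∀ σ → IsMPerm σ → HasProperBlockAround (vals σ) (mark σ) →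
  Σ MPerm λ τ → Σ MPerm λ α → IsMPerm τ × IsMPerm α × τ ⋆ α ≡ σ ×
    length (vals τ) < length (vals σ) × length (vals α) < length (vals σ)
proper-block⇒smaller-factors σ v (a , _ , k , _ , b , _ , W , 2≤k , k<n , a≤M , M<a+k)
  with block⇒factorisation (vals σ) (mark σ) (proj₁ v) a k b W a≤M M<a+k
... | factorisationAt τ α vτ vα τ⋆α≡σ _ refl _ = τ , α , vτ , vα , τ⋆α≡σ , τ< , k<n
  where
  τ< : length (vals τ) < length (vals σ)
  τ< = s≤s⁻¹ (begin
    suc (suc (length (vals τ)))  ≡⟨ +-comm 2 (length (vals τ)) ⟩
    length (vals τ) + 2          ≤⟨ +-monoʳ-≤ (length (vals τ)) 2≤k ⟩
    length (vals τ) + length (vals α)  ≡⟨ Inflation.suc-length τ α vτ vα ⟨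
    suc (length (vals (τ ⋆ α)))  ≡⟨ cong (λ ρ → suc (length (vals ρ))) τ⋆α≡σ ⟩
    suc (length (vals σ))        ∎)
    where open ≤-Reasoning

star-surjective : ∀ n σ → IsMPerm σ → length (vals σ) ≤ n → Σ (List MPerm) λ w → IsWord w × star w ≡ σ
star-surjective zero σ v l≤0 = ⊥-elim (<⇒≱ (≤-<-trans z≤n (proj₂ v)) l≤0)
star-surjective (suc n) σ v l≤n with length (vals σ) ≟ 1 | hasProperBlockAround? (vals σ) (mark σ)
... | yes l≡1 | _ = [] , [] , sym (length≡1⇒bar1 v l≡1)
... | no l≢1 | no no-block = [ σ ] , no-proper-block⇒irreducible σ v l≢1 no-block ∷ [] , ⋆-identityʳ σ v
... | no _ | yes block with proper-block⇒smaller-factors σ v block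
...   | τ , α , vτ , vα , τ⋆α≡σ , τ< , α< with star-surjective n τ vτ (s≤s⁻¹ (<-≤-trans τ< l≤n))
                                            | star-surjective n α vα (s≤s⁻¹ (<-≤-trans α< l≤n))
...   | wτ , iτ , ⋆wτ≡τ | wα , iα , ⋆wα≡α = wτ ++ wα , AllP.++⁺ iτ iα , (begin
  star (wτ ++ wα)       ≡⟨ star-++ wτ wα iτ iα ⟩
  star wτ ⋆ star wα     ≡⟨ cong₂ _⋆_ ⋆wτ≡τ ⋆wα≡α ⟩
  τ ⋆ α                 ≡⟨ τ⋆α≡σ ⟩
  σ                     ∎)
  where open ≡-Reasoning

⋆-length-< : ∀ ξ x → IsMPerm ξ → ¬ ξ ≡ bar1 → IsMPerm x → length (vals x) < length (vals (ξ ⋆ x))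
⋆-length-< ξ x vξ nξ vx = +-cancelˡ-< 1 (length (vals x)) (length (vals (ξ ⋆ x)))
  (subst (suc (suc (length (vals x))) ≤_) (sym (Inflation.suc-length ξ x vξ vx)) (+-monoˡ-≤ (length (vals x)) (≢bar1⇒2≤length vξ nξ)))

⋆-≢bar1 : ∀ ξ x → IsMPerm ξ → ¬ ξ ≡ bar1 → IsMPerm x → ¬ ξ ⋆ x ≡ bar1
⋆-≢bar1 ξ x vξ nξ vx e = <⇒≱ (subst (length (vals x) <_) (cong (λ z → length (vals z)) e) (⋆-length-< ξ x vξ nξ vx)) (≤-<-trans z≤n (proj₂ vx))

∼-∷ : ∀ x {w w′} → w ∼ w′ → (x ∷ w) ∼ (x ∷ w′)
∼-∷ x = EC.gmap (x ∷_) (λ (pre , suf , a , b , c , e₁ , e₂) → x ∷ pre , suf , a , b , c , cong (x ∷_) e₁ , cong (x ∷_) e₂)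

star-∷-length-< : ∀ ξ u → Irreducible ξ → IsWord u → length (vals (star u)) < length (vals (star (ξ ∷ u)))
star-∷-length-< ξ u iξ iu = ⋆-length-< ξ (star u) (Irreducible⇒IsMPerm iξ) (proj₁ (proj₂ iξ)) (star-isMPerm u iu)

star-∷-≢bar1 : ∀ ξ u → Irreducible ξ → IsWord u → star (ξ ∷ u) ≢ bar1
star-∷-≢bar1 ξ u iξ iu = ⋆-≢bar1 ξ (star u) (Irreducible⇒IsMPerm iξ) (proj₁ (proj₂ iξ)) (star-isMPerm u iu)

star-injective-mod-∼ : ∀ n w w′ → IsWord w → IsWord w′ → star w ≡ star w′ → length (vals (star w)) ≤ n → w ∼ w′
star-injective-mod-∼ _ [] [] _ _ _ _ = ε
star-injective-mod-∼ _ [] (η ∷ v) _ (iη ∷ iv) e _ = ⊥-elim (star-∷-≢bar1 η v iη iv (sym e))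
star-injective-mod-∼ _ (ξ ∷ u) [] (iξ ∷ iu) _ e _ = ⊥-elim (star-∷-≢bar1 ξ u iξ iu e)
star-injective-mod-∼ zero (ξ ∷ u) (η ∷ v) (iξ ∷ iu) (iη ∷ iv) e l≤0 =
  ⊥-elim (<⇒≱ (≤-<-trans z≤n (star-∷-length-< ξ u iξ iu)) l≤0)
star-injective-mod-∼ (suc n) (ξ ∷ u) (η ∷ v) (iξ ∷ iu) (iη ∷ iv) e l≤n
  with ⋆-diamond ξ (star u) η (star v) (Irreducible⇒IsMPerm iξ) (star-isMPerm u iu) (Irreducible⇒IsMPerm iη) (star-isMPerm v iv)
         (proj₁ (proj₂ iξ)) (proj₁ (proj₂ iη)) (proj₂ (proj₂ iξ)) (proj₂ (proj₂ iη)) (sym e)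
... | inj₁ (refl , u≡v) = ∼-∷ ξ (star-injective-mod-∼ n u v iu iv u≡v u≤n)
  where
  u≤n : length (vals (star u)) ≤ n
  u≤n = s≤s⁻¹ (<-≤-trans (star-∷-length-< ξ u iξ iu) l≤n)
-- ξ ∷ u ∼ ξ ∷ η ∷ g ∼ η ∷ ξ ∷ g ∼ η ∷ v, for any word g with star g ≡ γ.
... | inj₂ (γ , vγ , u≡ηγ , v≡ξγ , c) with star-surjective (length (vals γ)) γ vγ ≤-refl
...   | g , ig , ⋆g≡γ = ∼-∷ ξ u∼ηg ◅◅ EC.return ([] , g , ξ , η , c , refl , refl) ◅◅ EC.symmetric SwapStep (∼-∷ η v∼ξg)
  where
  u≤n : length (vals (star u)) ≤ n
  u≤n = s≤s⁻¹ (<-≤-trans (star-∷-length-< ξ u iξ iu) l≤n)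
  v≤n : length (vals (star v)) ≤ n
  v≤n = s≤s⁻¹ (<-≤-trans (star-∷-length-< η v iη iv) (subst (λ ρ → length (vals ρ) ≤ suc n) e l≤n))
  u∼ηg : u ∼ (η ∷ g)
  u∼ηg = star-injective-mod-∼ n u (η ∷ g) iu (iη ∷ ig) (trans u≡ηγ (cong (η ⋆_) (sym ⋆g≡γ))) u≤n
  v∼ξg : v ∼ (ξ ∷ g)
  v∼ξg = star-injective-mod-∼ n v (ξ ∷ g) iv (iξ ∷ ig) (trans v≡ξγ (cong (ξ ⋆_) (sym ⋆g≡γ))) v≤n

mainTheorem12 : (star [] ≡ bar1)
    × (∀ w → IsWord w → ValidMPerm (star w))
    × (∀ w w' → IsWord w → IsWord w' → star (w ++ w') ≡ star w ⋆ star w')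
    × (∀ w w' → IsWord w → IsWord w' → w ∼ w' → star w ≡ star w')
    × (∀ w w' → IsWord w → IsWord w' → star w ≡ star w' → w ∼ w')
    × (∀ σ → ValidMPerm σ → Σ (List MPerm) λ w → IsWord w × star w ≡ σ)
mainTheorem12 = refl ,
  (λ w iw → IsMPerm⇒Valid (star-isMPerm w iw)) ,
  star-++ ,
  (λ w w′ iw _ → ∼⇒star-≡ w w′ iw) ,
  (λ w w′ iw iw′ e → star-injective-mod-∼ (length (vals (star w))) w w′ iw iw′ e ≤-refl) ,
  (λ σ v → star-surjective (length (vals σ)) σ (Valid⇒IsMPerm v) ≤-refl)
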